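{- Let $y,q,z$ be indeterminates, and define the $2\times2$ matrices \[ M(w,z)=\begin{pmatrix} z(1-wq^2)^2 & -1-z\\ z(1+z)(1-wq^2)^2 & (1+wqy)(1+wqy^{ -1})z-(1+z)^2\end{pmatrix},\qquad S=\begin{pmatrix} zq^2 & \frac{1}{1-zqy}+\frac{1}{1-zqy^{ -1}}-1\\ 0 & 1\end{pmatrix}. \] For $n\ge0$ let \[ \Omega_n=M(q^{2n-2},z)^{ -1}\cdots M(q^2,z)^{ -1}M(1,z)^{ -1}\,S\,M(1,zq^2)M(q^2,zq^2)\cdots M(q^{2n-2},zq^2) \] (so $\Omega_0=S$). Then \[ \Omega_n=\frac{1}{(1-yzq)(1-y^{ -1}zq)}\begin{pmatrix} q^2z\left(2q^{2n}-zq^{2n+1}(y+y^{ -1})+z^2q^2-1\right) & 1-z^2q^2\\ (1-q^{2n})^2(z^2q^2-1)zq^2 & zq^{2n+1}(2qz-y-y^{ -1})+1-z^2q^2\end{pmatrix}. \]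
   Context: The matrices have entries in the field of rational functions $\mathbb Q(y,q,z)$; in the product defining $\Omega_n$ only the matrices $M(q^{2j},\cdot)$, $0\le j\le n-1$, appear. -}

module Defs where

-- A concrete model of the field Q(y,q,z) of rational functions:
-- polynomials in y,q,z over ℚ as (unnormalised) lists of terms, with
-- equality defined by equality of all coefficients; rational functions
-- as fractions num/den with cross-multiplication equality.  Inverse uses
-- the convention 0⁻¹ = 0 (only applied here to nonzero elements).

open import Data.Rational as ℚ using (ℚ; 0ℚ; 1ℚ)
open import Data.Nat as ℕ using (ℕ; zero; suc)
open import Data.Product using (_×_; _,_; proj₁; proj₂)
open import Data.Product.Properties using (≡-dec)
open import Data.List using (List; []; _∷_; _++_; map; concatMap; foldr)
open import Data.List.Relation.Unary.All using (All; all?)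
open import Relation.Binary.PropositionalEquality using (_≡_)
open import Relation.Nullary.Decidable using (Dec; does)
open import Data.Bool using (if_then_else_)

-- exponents of (y , q , z)
Mono : Set
Mono = ℕ × ℕ × ℕ

_≟ₘ_ : (m m' : Mono) → Dec (m ≡ m')
_≟ₘ_ = ≡-dec ℕ._≟_ (≡-dec ℕ._≟_ ℕ._≟_)

_+ₘ_ : Mono → Mono → Mono
(a , b , c) +ₘ (a' , b' , c') = (a ℕ.+ a') , (b ℕ.+ b') , (c ℕ.+ c')

Poly : Set
Poly = List (ℚ × Mono)

coeff : Poly → Mono → ℚ
coeff [] m = 0ℚ
coeff ((c , m') ∷ p) m = if does (m' ≟ₘ m) then c ℚ.+ coeff p m else coeff p m

_≈ₚ_ : Poly → Poly → Set
p ≈ₚ p' = ∀ m → coeff p m ≡ coeff p' m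

isZero? : (p : Poly) → Dec (All (λ t → coeff p (proj₂ t) ≡ 0ℚ) p)
isZero? p = all? (λ t → coeff p (proj₂ t) ℚ.≟ 0ℚ) p

_+ₚ_ : Poly → Poly → Poly
p +ₚ p' = p ++ p'

-ₚ_ : Poly → Poly
-ₚ p = map (λ t → ℚ.- proj₁ t , proj₂ t) p

_*ₚ_ : Poly → Poly → Poly
p *ₚ p' = concatMap (λ t → map (λ t' → proj₁ t ℚ.* proj₁ t' , proj₂ t +ₘ proj₂ t') p') p

constₚ : ℚ → Poly
constₚ c = (c , 0 , 0 , 0) ∷ []

record K : Set where
  constructor _/_
  field
    num : Poly
    den : Poly
open K public

_≈_ : K → K → Set
a ≈ b = (num a *ₚ den b) ≈ₚ (num b *ₚ den a)

infixl 6 _+_ _-_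
infixl 7 _*_
infix 4 _≈_

_+_ : K → K → K
a + b = ((num a *ₚ den b) +ₚ (num b *ₚ den a)) / (den a *ₚ den b)

-_ : K → K
- a = (-ₚ num a) / den a

_-_ : K → K → K
a - b = a + (- b)

_*_ : K → K → K
a * b = (num a *ₚ num b) / (den a *ₚ den b)

fromℚ : ℚ → K
fromℚ c = constₚ c / constₚ 1ℚ

0K 1K : K
0K = fromℚ 0ℚ
1K = fromℚ 1ℚ

_⁻¹ : K → K
a ⁻¹ = if does (isZero? (num a)) then 0K else (den a / num a)

_^_ : K → ℕ → K
a ^ zero = 1K
a ^ suc n = a * (a ^ n)

y q z : K
y = ((1ℚ , 1 , 0 , 0) ∷ []) / constₚ 1ℚ
q = ((1ℚ , 0 , 1 , 0) ∷ []) / constₚ 1ℚ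
z = ((1ℚ , 0 , 0 , 1) ∷ []) / constₚ 1ℚ

2K : K
2K = 1K + 1K

record Mat : Set where
  constructor mat
  field
    m₁₁ m₁₂ m₂₁ m₂₂ : K
open Mat public

_≈M_ : Mat → Mat → Set
A ≈M B = (m₁₁ A ≈ m₁₁ B) × (m₁₂ A ≈ m₁₂ B) × (m₂₁ A ≈ m₂₁ B) × (m₂₂ A ≈ m₂₂ B)

infix 4 _≈M_
infixl 7 _·_

_·_ : Mat → Mat → Mat
A · B = mat (m₁₁ A * m₁₁ B + m₁₂ A * m₂₁ B) (m₁₁ A * m₁₂ B + m₁₂ A * m₂₂ B)
            (m₂₁ A * m₁₁ B + m₂₂ A * m₂₁ B) (m₂₁ A * m₁₂ B + m₂₂ A * m₂₂ B)

I₂ : Mat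
I₂ = mat 1K 0K 0K 1K

scale : K → Mat → Mat
scale c A = mat (c * m₁₁ A) (c * m₁₂ A) (c * m₂₁ A) (c * m₂₂ A)

det : Mat → K
det A = m₁₁ A * m₂₂ A - m₁₂ A * m₂₁ A

inv : Mat → Mat
inv A = scale (det A ⁻¹) (mat (m₂₂ A) (- m₁₂ A) (- m₂₁ A) (m₁₁ A))

Mwz : K → K → Mat
Mwz w z' = mat (z' * ((1K - w * q ^ 2) ^ 2))
               (- 1K - z')
               (z' * (1K + z') * ((1K - w * q ^ 2) ^ 2))
               ((1K + w * q * y) * (1K + w * q * y ⁻¹) * z' - (1K + z') ^ 2)

S : Mat
S = mat (z * q ^ 2) ((1K - z * q * y) ⁻¹ + (1K - z * q * y ⁻¹) ⁻¹ - 1K) 0K 1K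

-- L n = M(q^{2n-2},z)^{-1} ⋯ M(1,z)^{-1},   R n = M(1,zq²) ⋯ M(q^{2n-2},zq²)
Lprod : ℕ → Mat
Lprod zero = I₂
Lprod (suc n) = inv (Mwz (q ^ (2 ℕ.* n)) z) · Lprod n

Rprod : ℕ → Mat
Rprod zero = I₂
Rprod (suc n) = Rprod n · Mwz (q ^ (2 ℕ.* n)) (z * q ^ 2)

Ω : ℕ → Mat
Ω n = Lprod n · S · Rprod n

Ωclosed : ℕ → Mat
Ωclosed n = scale (((1K - y * z * q) * (1K - y ⁻¹ * z * q)) ⁻¹)
  (mat (q ^ 2 * z * (2K * q ^ (2 ℕ.* n) - z * q ^ (2 ℕ.* n ℕ.+ 1) * (y + y ⁻¹) + z ^ 2 * q ^ 2 - 1K))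
       (1K - z ^ 2 * q ^ 2)
       ((1K - q ^ (2 ℕ.* n)) ^ 2 * (z ^ 2 * q ^ 2 - 1K) * z * q ^ 2)
       (z * q ^ (2 ℕ.* n ℕ.+ 1) * (2K * q * z - y - y ⁻¹) + 1K - z ^ 2 * q ^ 2))

module Submission where

-- Write C(a,b) for the closed form with q^{2n}, q^{2n+1} replaced by
-- a, b, so that C_n = C(q^{2n}, q^{2n+1}).  Two polynomial identities carry
-- the proof:  C(1,q) = S  and the intertwining relation
--     M(w,z) · C(wq², wq³) = C(w, wq) · M(w, zq²).
-- With w = q^{2k} the latter reads M(q^{2k},z) · C_{k+1} = C_k · M(q^{2k},zq²),
-- and telescoping gives  M(1,z) ⋯ M(q^{2n-2},z) · C_n = S · M(1,zq²) ⋯ M(q^{2n-2},zq²),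
-- i.e. Ω_n = C_n once the M(q^{2k},z) are known to be invertible.


module FiniteSums where

  open import Data.Rational as ℚ using (ℚ; 0ℚ)
  import Data.Rational.Properties as ℚP
  open import Data.List using (List; []; _∷_; _++_; map; concatMap)
  open import Relation.Binary.PropositionalEquality
  open import Algebra.Bundles using (CommutativeMonoid)
  open import Algebra.Properties.CommutativeSemigroup
    (CommutativeMonoid.commutativeSemigroup ℚP.+-0-commutativeMonoid) using (interchange)

  private
    variable
      A B : Set

  sumBy : (A → ℚ) → List A → ℚ
  sumBy f []       = 0ℚ
  sumBy f (x ∷ xs) = f x ℚ.+ sumBy f xs

  sumBy-cong : {f g : A → ℚ} → (∀ x → f x ≡ g x) → ∀ xs → sumBy f xs ≡ sumBy g xs
  sumBy-cong f≡g []       = refl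
  sumBy-cong f≡g (x ∷ xs) = cong₂ ℚ._+_ (f≡g x) (sumBy-cong f≡g xs)

  sumBy-++ : (f : A → ℚ) (xs ys : List A) → sumBy f (xs ++ ys) ≡ sumBy f xs ℚ.+ sumBy f ys
  sumBy-++ f []       ys = sym (ℚP.+-identityˡ _)
  sumBy-++ f (x ∷ xs) ys =
    trans (cong (f x ℚ.+_) (sumBy-++ f xs ys)) (sym (ℚP.+-assoc (f x) _ _))

  sumBy-zero : (xs : List A) → sumBy (λ _ → 0ℚ) xs ≡ 0ℚ
  sumBy-zero []       = refl
  sumBy-zero (x ∷ xs) = trans (ℚP.+-identityˡ _) (sumBy-zero xs)

  sumBy-+ : (f g : A → ℚ) (xs : List A) →
            sumBy (λ x → f x ℚ.+ g x) xs ≡ sumBy f xs ℚ.+ sumBy g xs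
  sumBy-+ f g []       = sym (ℚP.+-identityˡ 0ℚ)
  sumBy-+ f g (x ∷ xs) =
    trans (cong (f x ℚ.+ g x ℚ.+_) (sumBy-+ f g xs)) (interchange (f x) (g x) _ _)

  sumBy-neg : (f : A → ℚ) (xs : List A) → sumBy (λ x → ℚ.- f x) xs ≡ ℚ.- sumBy f xs
  sumBy-neg f []       = refl
  sumBy-neg f (x ∷ xs) =
    trans (cong (ℚ.- f x ℚ.+_) (sumBy-neg f xs)) (sym (ℚP.neg-distrib-+ (f x) _))

  sumBy-*ˡ : (c : ℚ) (f : A → ℚ) (xs : List A) → sumBy (λ x → c ℚ.* f x) xs ≡ c ℚ.* sumBy f xs
  sumBy-*ˡ c f []       = sym (ℚP.*-zeroʳ c)
  sumBy-*ˡ c f (x ∷ xs) =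
    trans (cong (c ℚ.* f x ℚ.+_) (sumBy-*ˡ c f xs)) (sym (ℚP.*-distribˡ-+ c (f x) _))

  sumBy-*ʳ : (c : ℚ) (f : A → ℚ) (xs : List A) → sumBy (λ x → f x ℚ.* c) xs ≡ sumBy f xs ℚ.* c
  sumBy-*ʳ c f xs =
    trans (sumBy-cong (λ x → ℚP.*-comm (f x) c) xs) (trans (sumBy-*ˡ c f xs) (ℚP.*-comm c _))

  sumBy-map : (f : B → ℚ) (h : A → B) (xs : List A) → sumBy f (map h xs) ≡ sumBy (λ x → f (h x)) xs
  sumBy-map f h []       = refl
  sumBy-map f h (x ∷ xs) = cong (f (h x) ℚ.+_) (sumBy-map f h xs)

  sumBy-concatMap : (f : B → ℚ) (h : A → List B) (xs : List A) →
                    sumBy f (concatMap h xs) ≡ sumBy (λ x → sumBy f (h x)) xs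
  sumBy-concatMap f h []       = refl
  sumBy-concatMap f h (x ∷ xs) =
    trans (sumBy-++ f (h x) (concatMap h xs)) (cong (sumBy f (h x) ℚ.+_) (sumBy-concatMap f h xs))

  sumBy-swap : (f : A → B → ℚ) (xs : List A) (ys : List B) →
               sumBy (λ x → sumBy (f x) ys) xs ≡ sumBy (λ y → sumBy (λ x → f x y) xs) ys
  sumBy-swap f []       ys = sym (sumBy-zero ys)
  sumBy-swap f (x ∷ xs) ys =
    trans (cong (sumBy (f x) ys ℚ.+_) (sumBy-swap f xs ys))
          (sym (sumBy-+ (f x) (λ y → sumBy (λ x → f x y) xs) ys))


module PolynomialRing where

  -- Each coefficient is a finite sum over
  -- the term list, so every ring law reduces to a law of finite sums.

  open import Defs using (Mono; _≟ₘ_; _+ₘ_; Poly; coeff; _≈ₚ_; _+ₚ_; -ₚ_; _*ₚ_; constₚ)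
  open FiniteSums
  open import Data.Rational as ℚ using (ℚ; 0ℚ; 1ℚ)
  import Data.Rational.Properties as ℚP
  open import Data.Nat as ℕ using (ℕ; zero; suc)
  import Data.Nat.Properties as ℕP
  open import Data.Product using (_×_; _,_; proj₁; proj₂)
  open import Data.List using ([]; _∷_; _++_; map)
  open import Data.Bool using (true; false; if_then_else_)
  open import Data.Maybe using (Maybe; just; nothing)
  import Data.Maybe.Properties as MaybeP
  open import Relation.Nullary.Decidable using (does; yes; no; dec-true; dec-false)
  open import Relation.Binary.PropositionalEquality
  open import Algebra.Bundles using (CommutativeRing)
  open import Level using (0ℓ)

  +ₘ-comm : ∀ a b → a +ₘ b ≡ b +ₘ a
  +ₘ-comm (a , b , c) (a' , b' , c') =
    cong₂ _,_ (ℕP.+-comm a a') (cong₂ _,_ (ℕP.+-comm b b') (ℕP.+-comm c c'))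

  +ₘ-assoc : ∀ a b c → (a +ₘ b) +ₘ c ≡ a +ₘ (b +ₘ c)
  +ₘ-assoc (a , b , c) (a' , b' , c') (a'' , b'' , c'') =
    cong₂ _,_ (ℕP.+-assoc a a' a'') (cong₂ _,_ (ℕP.+-assoc b b' b'') (ℕP.+-assoc c c' c''))

  _∸?_ : ℕ → ℕ → Maybe ℕ
  m     ∸? zero  = just m
  zero  ∸? suc a = nothing
  suc m ∸? suc a = m ∸? a

  +-∸? : ∀ a d → (a ℕ.+ d) ∸? a ≡ just d
  +-∸? zero    d = refl
  +-∸? (suc a) d = +-∸? a d

  ∸?-sound : ∀ m a d → m ∸? a ≡ just d → a ℕ.+ d ≡ m
  ∸?-sound m       zero    d refl = refl
  ∸?-sound (suc m) (suc a) d e    = cong suc (∸?-sound m a d e)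

  _∸ₘ_ : Mono → Mono → Maybe Mono
  (m₁ , m₂ , m₃) ∸ₘ (a₁ , a₂ , a₃) with m₁ ∸? a₁ | m₂ ∸? a₂ | m₃ ∸? a₃
  ... | just d₁ | just d₂ | just d₃ = just (d₁ , d₂ , d₃)
  ... | _       | _       | _       = nothing

  +ₘ-∸ₘ : ∀ a d → (a +ₘ d) ∸ₘ a ≡ just d
  +ₘ-∸ₘ (a₁ , a₂ , a₃) (d₁ , d₂ , d₃)
    rewrite +-∸? a₁ d₁ | +-∸? a₂ d₂ | +-∸? a₃ d₃ = refl

  ∸ₘ-complete : ∀ m a d → d +ₘ a ≡ m → m ∸ₘ a ≡ just d
  ∸ₘ-complete m a d da≡m = trans (cong (_∸ₘ a) (trans (sym da≡m) (+ₘ-comm d a))) (+ₘ-∸ₘ a d)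

  ∸ₘ-sound : ∀ m a d → m ∸ₘ a ≡ just d → a +ₘ d ≡ m
  ∸ₘ-sound (m₁ , m₂ , m₃) (a₁ , a₂ , a₃) d e
    with m₁ ∸? a₁ in e₁ | m₂ ∸? a₂ in e₂ | m₃ ∸? a₃ in e₃
  ∸ₘ-sound (m₁ , m₂ , m₃) (a₁ , a₂ , a₃) d refl | just d₁ | just d₂ | just d₃ =
    cong₂ _,_ (∸?-sound m₁ a₁ d₁ e₁) (cong₂ _,_ (∸?-sound m₂ a₂ d₂ e₂) (∸?-sound m₃ a₃ d₃ e₃))
  ∸ₘ-sound _ _ d () | just _  | just _  | nothing
  ∸ₘ-sound _ _ d () | just _  | nothing | _
  ∸ₘ-sound _ _ d () | nothing | _       | _

  Term : Set
  Term = ℚ × Mono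

  contrib : Term → Mono → ℚ
  contrib (c , m') m = if does (m' ≟ₘ m) then c else 0ℚ

  coeff-sum : ∀ p m → coeff p m ≡ sumBy (λ t → contrib t m) p
  coeff-sum []             m = refl
  coeff-sum ((c , m') ∷ p) m with does (m' ≟ₘ m)
  ... | true  = cong (c ℚ.+_) (coeff-sum p m)
  ... | false = trans (coeff-sum p m) (sym (ℚP.+-identityˡ _))

  coeff-+ : ∀ p r m → coeff (p +ₚ r) m ≡ coeff p m ℚ.+ coeff r m
  coeff-+ p r m = begin
    coeff (p ++ r) m                                           ≡⟨ coeff-sum (p ++ r) m ⟩
    sumBy (λ t → contrib t m) (p ++ r)                         ≡⟨ sumBy-++ _ p r ⟩
    sumBy (λ t → contrib t m) p ℚ.+ sumBy (λ t → contrib t m) r ≡⟨ sym (cong₂ ℚ._+_ (coeff-sum p m) (coeff-sum r m)) ⟩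
    coeff p m ℚ.+ coeff r m                                    ∎
    where open ≡-Reasoning

  contrib-neg : ∀ t m → contrib (ℚ.- proj₁ t , proj₂ t) m ≡ ℚ.- contrib t m
  contrib-neg (c , m') m with does (m' ≟ₘ m)
  ... | true  = refl
  ... | false = refl

  coeff-neg : ∀ p m → coeff (-ₚ p) m ≡ ℚ.- coeff p m
  coeff-neg p m = begin
    coeff (-ₚ p) m                                      ≡⟨ coeff-sum (-ₚ p) m ⟩
    sumBy (λ t → contrib t m) (-ₚ p)                    ≡⟨ sumBy-map _ _ p ⟩
    sumBy (λ t → contrib (ℚ.- proj₁ t , proj₂ t) m) p   ≡⟨ sumBy-cong (λ t → contrib-neg t m) p ⟩
    sumBy (λ t → ℚ.- contrib t m) p                     ≡⟨ sumBy-neg _ p ⟩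
    ℚ.- sumBy (λ t → contrib t m) p                     ≡⟨ cong ℚ.-_ (sym (coeff-sum p m)) ⟩
    ℚ.- coeff p m                                       ∎
    where open ≡-Reasoning

  _*ₜ_ : Term → Term → Term
  (c , m) *ₜ (c' , m') = (c ℚ.* c' , m +ₘ m')

  coeff-* : ∀ p r m → coeff (p *ₚ r) m ≡ sumBy (λ t → sumBy (λ s → contrib (t *ₜ s) m) r) p
  coeff-* p r m =
    trans (coeff-sum (p *ₚ r) m) (trans (sumBy-concatMap _ _ p) (sumBy-cong (λ t → sumBy-map _ _ r) p))

  coeffAt : Poly → Maybe Mono → ℚ
  coeffAt p nothing  = 0ℚ
  coeffAt p (just d) = coeff p d

  contribAt : Term → Maybe Mono → ℚ
  contribAt t nothing  = 0ℚ
  contribAt t (just d) = contrib t d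

  coeffAt-sum : ∀ p u → coeffAt p u ≡ sumBy (λ t → contribAt t u) p
  coeffAt-sum p nothing  = sym (sumBy-zero p)
  coeffAt-sum p (just d) = coeff-sum p d

  coeffAt-cong : ∀ {p p'} → p ≈ₚ p' → ∀ u → coeffAt p u ≡ coeffAt p' u
  coeffAt-cong p≈p' nothing  = refl
  coeffAt-cong p≈p' (just d) = p≈p' d

  contrib-shift : ∀ a t m → contrib (proj₁ t , proj₂ t +ₘ a) m ≡ contribAt t (m ∸ₘ a)
  contrib-shift a (c , m') m with m ∸ₘ a in e | (m' +ₘ a) ≟ₘ m
  ... | nothing | yes m'a≡m with () ← trans (sym e) (∸ₘ-complete m a m' m'a≡m)
  ... | nothing | no _ = refl
  ... | just d  | yes m'a≡m = sym (cong (λ b → if b then c else 0ℚ) (dec-true (m' ≟ₘ d) m'≡d))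
    where
    m'≡d : m' ≡ d
    m'≡d = MaybeP.just-injective (trans (sym (∸ₘ-complete m a m' m'a≡m)) e)
  ... | just d  | no m'a≢m = sym (cong (λ b → if b then c else 0ℚ) (dec-false (m' ≟ₘ d) λ m'≡d →
    m'a≢m (trans (+ₘ-comm m' a) (trans (cong (a +ₘ_) m'≡d) (∸ₘ-sound m a d e)))))

  coeff-*-grouped : ∀ p r m → coeff (p *ₚ r) m ≡ sumBy (λ s → coeffAt p (m ∸ₘ proj₂ s) ℚ.* proj₁ s) r
  coeff-*-grouped p r m = begin
    coeff (p *ₚ r) m
      ≡⟨ coeff-* p r m ⟩
    sumBy (λ t → sumBy (λ s → contrib (t *ₜ s) m) r) p
      ≡⟨ sumBy-swap (λ t s → contrib (t *ₜ s) m) p r ⟩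
    sumBy (λ s → sumBy (λ t → contrib (t *ₜ s) m) p) r
      ≡⟨ sumBy-cong (λ s → trans (sumBy-cong (λ t → factor t s) p) (sumBy-*ʳ (proj₁ s) _ p)) r ⟩
    sumBy (λ s → sumBy (λ t → contribAt t (m ∸ₘ proj₂ s)) p ℚ.* proj₁ s) r
      ≡⟨ sumBy-cong (λ s → cong (ℚ._* proj₁ s) (sym (coeffAt-sum p (m ∸ₘ proj₂ s)))) r ⟩
    sumBy (λ s → coeffAt p (m ∸ₘ proj₂ s) ℚ.* proj₁ s) r ∎
    where
    open ≡-Reasoning
    factor : ∀ t s → contrib (t *ₜ s) m ≡ contribAt t (m ∸ₘ proj₂ s) ℚ.* proj₁ s
    factor (c , m') (c' , a) with does ((m' +ₘ a) ≟ₘ m) | contrib-shift a (c , m') m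
    ... | true  | e = cong (ℚ._* c') e
    ... | false | e = trans (sym (ℚP.*-zeroˡ c')) (cong (ℚ._* c') e)

  *ₜ-comm : ∀ t s → t *ₜ s ≡ s *ₜ t
  *ₜ-comm (c , m) (c' , m') = cong₂ _,_ (ℚP.*-comm c c') (+ₘ-comm m m')

  *ₜ-assoc : ∀ t s u → (t *ₜ s) *ₜ u ≡ t *ₜ (s *ₜ u)
  *ₜ-assoc (c , m) (c' , m') (c'' , m'') = cong₂ _,_ (ℚP.*-assoc c c' c'') (+ₘ-assoc m m' m'')

  +ₚ-cong : ∀ {p p' r r'} → p ≈ₚ p' → r ≈ₚ r' → (p +ₚ r) ≈ₚ (p' +ₚ r')
  +ₚ-cong {p} {p'} {r} {r'} p≈p' r≈r' m =
    trans (coeff-+ p r m) (trans (cong₂ ℚ._+_ (p≈p' m) (r≈r' m)) (sym (coeff-+ p' r' m)))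

  +ₚ-assoc : ∀ p r u → ((p +ₚ r) +ₚ u) ≈ₚ (p +ₚ (r +ₚ u))
  +ₚ-assoc p r u m = begin
    coeff ((p ++ r) ++ u) m                   ≡⟨ coeff-+ (p ++ r) u m ⟩
    coeff (p ++ r) m ℚ.+ coeff u m            ≡⟨ cong (ℚ._+ coeff u m) (coeff-+ p r m) ⟩
    coeff p m ℚ.+ coeff r m ℚ.+ coeff u m     ≡⟨ ℚP.+-assoc (coeff p m) (coeff r m) (coeff u m) ⟩
    coeff p m ℚ.+ (coeff r m ℚ.+ coeff u m)   ≡⟨ cong (coeff p m ℚ.+_) (sym (coeff-+ r u m)) ⟩
    coeff p m ℚ.+ coeff (r ++ u) m            ≡⟨ sym (coeff-+ p (r ++ u) m) ⟩
    coeff (p ++ (r ++ u)) m                   ∎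
    where open ≡-Reasoning

  +ₚ-comm : ∀ p r → (p +ₚ r) ≈ₚ (r +ₚ p)
  +ₚ-comm p r m =
    trans (coeff-+ p r m) (trans (ℚP.+-comm (coeff p m) (coeff r m)) (sym (coeff-+ r p m)))

  +ₚ-identityʳ : ∀ p → (p +ₚ []) ≈ₚ p
  +ₚ-identityʳ p m = trans (coeff-+ p [] m) (ℚP.+-identityʳ (coeff p m))

  -ₚ-cong : ∀ {p p'} → p ≈ₚ p' → (-ₚ p) ≈ₚ (-ₚ p')
  -ₚ-cong {p} {p'} p≈p' m = trans (coeff-neg p m) (trans (cong ℚ.-_ (p≈p' m)) (sym (coeff-neg p' m)))

  -ₚ-inverseˡ : ∀ p → ((-ₚ p) +ₚ p) ≈ₚ []
  -ₚ-inverseˡ p m =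
    trans (coeff-+ (-ₚ p) p m) (trans (cong (ℚ._+ coeff p m) (coeff-neg p m)) (ℚP.+-inverseˡ (coeff p m)))

  -ₚ-inverseʳ : ∀ p → (p +ₚ (-ₚ p)) ≈ₚ []
  -ₚ-inverseʳ p m =
    trans (coeff-+ p (-ₚ p) m) (trans (cong (coeff p m ℚ.+_) (coeff-neg p m)) (ℚP.+-inverseʳ (coeff p m)))

  *ₚ-comm : ∀ p r → (p *ₚ r) ≈ₚ (r *ₚ p)
  *ₚ-comm p r m = begin
    coeff (p *ₚ r) m                                      ≡⟨ coeff-* p r m ⟩
    sumBy (λ t → sumBy (λ s → contrib (t *ₜ s) m) r) p    ≡⟨ sumBy-swap (λ t s → contrib (t *ₜ s) m) p r ⟩
    sumBy (λ s → sumBy (λ t → contrib (t *ₜ s) m) p) r    ≡⟨ sumBy-cong (λ s → sumBy-cong (λ t → cong (λ u → contrib u m) (*ₜ-comm t s)) p) r ⟩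
    sumBy (λ s → sumBy (λ t → contrib (s *ₜ t) m) p) r    ≡⟨ sym (coeff-* r p m) ⟩
    coeff (r *ₚ p) m                                      ∎
    where open ≡-Reasoning

  *ₚ-assoc : ∀ p r u → ((p *ₚ r) *ₚ u) ≈ₚ (p *ₚ (r *ₚ u))
  *ₚ-assoc p r u m = begin
    coeff ((p *ₚ r) *ₚ u) m
      ≡⟨ coeff-* (p *ₚ r) u m ⟩
    sumBy (λ ts → sumBy (λ v → contrib (ts *ₜ v) m) u) (p *ₚ r)
      ≡⟨ sumBy-concatMap _ _ p ⟩
    sumBy (λ t → sumBy (λ ts → sumBy (λ v → contrib (ts *ₜ v) m) u) (map (t *ₜ_) r)) p
      ≡⟨ sumBy-cong (λ t → sumBy-map _ _ r) p ⟩
    sumBy (λ t → sumBy (λ s → sumBy (λ v → contrib ((t *ₜ s) *ₜ v) m) u) r) p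
      ≡⟨ sumBy-cong (λ t → sumBy-cong (λ s → sumBy-cong (λ v → cong (λ w → contrib w m) (*ₜ-assoc t s v)) u) r) p ⟩
    sumBy (λ t → sumBy (λ s → sumBy (λ v → contrib (t *ₜ (s *ₜ v)) m) u) r) p
      ≡⟨ sumBy-cong (λ t → sym (trans (sumBy-concatMap _ _ r) (sumBy-cong (λ s → sumBy-map _ _ u) r))) p ⟩
    sumBy (λ t → sumBy (λ sv → contrib (t *ₜ sv) m) (r *ₚ u)) p
      ≡⟨ sym (coeff-* p (r *ₚ u) m) ⟩
    coeff (p *ₚ (r *ₚ u)) m ∎
    where open ≡-Reasoning

  *ₚ-congʳ : ∀ {p p'} r → p ≈ₚ p' → (p *ₚ r) ≈ₚ (p' *ₚ r)
  *ₚ-congʳ {p} {p'} r p≈p' m =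
    trans (coeff-*-grouped p r m)
      (trans (sumBy-cong (λ s → cong (ℚ._* proj₁ s) (coeffAt-cong p≈p' (m ∸ₘ proj₂ s))) r)
             (sym (coeff-*-grouped p' r m)))

  *ₚ-cong : ∀ {p p' r r'} → p ≈ₚ p' → r ≈ₚ r' → (p *ₚ r) ≈ₚ (p' *ₚ r')
  *ₚ-cong {p} {p'} {r} {r'} p≈p' r≈r' m =
    trans (*ₚ-congʳ {p} {p'} r p≈p' m)
      (trans (*ₚ-comm p' r m) (trans (*ₚ-congʳ {r} {r'} p' r≈r' m) (*ₚ-comm r' p' m)))

  *ₚ-distribʳ : ∀ r p u → ((p +ₚ u) *ₚ r) ≈ₚ ((p *ₚ r) +ₚ (u *ₚ r))
  *ₚ-distribʳ r p u m = begin
    coeff ((p ++ u) *ₚ r) m                                                 ≡⟨ coeff-* (p ++ u) r m ⟩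
    sumBy f (p ++ u)                                                        ≡⟨ sumBy-++ f p u ⟩
    sumBy f p ℚ.+ sumBy f u                                                 ≡⟨ sym (cong₂ ℚ._+_ (coeff-* p r m) (coeff-* u r m)) ⟩
    coeff (p *ₚ r) m ℚ.+ coeff (u *ₚ r) m                                   ≡⟨ sym (coeff-+ (p *ₚ r) (u *ₚ r) m) ⟩
    coeff ((p *ₚ r) +ₚ (u *ₚ r)) m                                          ∎
    where
    open ≡-Reasoning
    f : Term → ℚ
    f t = sumBy (λ s → contrib (t *ₜ s) m) r

  *ₚ-distribˡ : ∀ p r u → (p *ₚ (r +ₚ u)) ≈ₚ ((p *ₚ r) +ₚ (p *ₚ u))
  *ₚ-distribˡ p r u m = begin
    coeff (p *ₚ (r +ₚ u)) m                ≡⟨ *ₚ-comm p (r +ₚ u) m ⟩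
    coeff ((r +ₚ u) *ₚ p) m                ≡⟨ *ₚ-distribʳ p r u m ⟩
    coeff ((r *ₚ p) +ₚ (u *ₚ p)) m         ≡⟨ +ₚ-cong {r *ₚ p} {p *ₚ r} {u *ₚ p} {p *ₚ u} (*ₚ-comm r p) (*ₚ-comm u p) m ⟩
    coeff ((p *ₚ r) +ₚ (p *ₚ u)) m         ∎
    where open ≡-Reasoning

  *ₚ-identityˡ : ∀ p → (constₚ 1ℚ *ₚ p) ≈ₚ p
  *ₚ-identityˡ p m = begin
    coeff (constₚ 1ℚ *ₚ p) m                                       ≡⟨ coeff-* (constₚ 1ℚ) p m ⟩
    sumBy (λ s → contrib ((1ℚ , 0 , 0 , 0) *ₜ s) m) p ℚ.+ 0ℚ       ≡⟨ ℚP.+-identityʳ _ ⟩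
    sumBy (λ s → contrib ((1ℚ , 0 , 0 , 0) *ₜ s) m) p              ≡⟨ sumBy-cong (λ s → cong (λ c → contrib (c , proj₂ s) m) (ℚP.*-identityˡ (proj₁ s))) p ⟩
    sumBy (λ s → contrib s m) p                                    ≡⟨ sym (coeff-sum p m) ⟩
    coeff p m                                                      ∎
    where open ≡-Reasoning

  *ₚ-identityʳ : ∀ p → (p *ₚ constₚ 1ℚ) ≈ₚ p
  *ₚ-identityʳ p m = trans (*ₚ-comm p (constₚ 1ℚ) m) (*ₚ-identityˡ p m)

  -- The equality of the ring: ≈ₚ wrapped in a record, so that it is a
  -- data-like type from which Agda can recover the two polynomials.
  infix 4 _≋_
  record _≋_ (p r : Poly) : Set where
    constructor ≋⟨_⟩
    field coeffwise : p ≈ₚ r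
  open _≋_ public

  polyRing : CommutativeRing 0ℓ 0ℓ
  polyRing = record
    { Carrier = Poly ; _≈_ = _≋_ ; _+_ = _+ₚ_ ; _*_ = _*ₚ_ ; -_ = -ₚ_ ; 0# = [] ; 1# = constₚ 1ℚ
    ; isCommutativeRing = record
      { isRing = record
        { +-isAbelianGroup = record
          { isGroup = record
            { isMonoid = record
              { isSemigroup = record
                { isMagma = record
                  { isEquivalence = record
                    { refl  = ≋⟨ (λ m → refl) ⟩
                    ; sym   = λ p≈r → ≋⟨ (λ m → sym (coeffwise p≈r m)) ⟩
                    ; trans = λ p≈r r≈u → ≋⟨ (λ m → trans (coeffwise p≈r m) (coeffwise r≈u m)) ⟩ }
                  ; ∙-cong = λ {p} {p'} {r} {r'} p≈p' r≈r' →
                      ≋⟨ +ₚ-cong {p} {p'} {r} {r'} (coeffwise p≈p') (coeffwise r≈r') ⟩ }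
                ; assoc = λ p r u → ≋⟨ +ₚ-assoc p r u ⟩ }
              ; identity = (λ p → ≋⟨ (λ m → refl) ⟩) , (λ p → ≋⟨ +ₚ-identityʳ p ⟩) }
            ; inverse = (λ p → ≋⟨ -ₚ-inverseˡ p ⟩) , (λ p → ≋⟨ -ₚ-inverseʳ p ⟩)
            ; ⁻¹-cong = λ {p} {p'} p≈p' → ≋⟨ -ₚ-cong {p} {p'} (coeffwise p≈p') ⟩ }
          ; comm = λ p r → ≋⟨ +ₚ-comm p r ⟩ }
        ; *-cong = λ {p} {p'} {r} {r'} p≈p' r≈r' →
            ≋⟨ *ₚ-cong {p} {p'} {r} {r'} (coeffwise p≈p') (coeffwise r≈r') ⟩
        ; *-assoc = λ p r u → ≋⟨ *ₚ-assoc p r u ⟩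
        ; *-identity = (λ p → ≋⟨ *ₚ-identityˡ p ⟩) , (λ p → ≋⟨ *ₚ-identityʳ p ⟩)
        ; distrib = (λ p r u → ≋⟨ *ₚ-distribˡ p r u ⟩) , (λ r p u → ≋⟨ *ₚ-distribʳ r p u ⟩) }
      ; *-comm = λ p r → ≋⟨ *ₚ-comm p r ⟩ } }


module PolynomialSolver where

  open import Defs using (constₚ; coeff; _+ₚ_; _≟ₘ_)
  open PolynomialRing
  open import Data.Rational as ℚ using (ℚ; 0ℚ)
  import Data.Rational.Properties as ℚP
  open import Data.Product using (_,_)
  open import Data.List using ([])
  open import Data.Bool using (true; false)
  open import Data.Maybe using (Maybe; just; nothing)
  open import Relation.Binary.PropositionalEquality
  open import Relation.Nullary.Decidable using (does; yes; no)
  open import Algebra.Solver.Ring.AlmostCommutativeRing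

  constₚ-+ : ∀ a b → constₚ (a ℚ.+ b) ≋ (constₚ a +ₚ constₚ b)
  constₚ-+ a b = ≋⟨ at ⟩
    where
    at : ∀ m → coeff (constₚ (a ℚ.+ b)) m ≡ coeff (constₚ a +ₚ constₚ b) m
    at m with does ((0 , 0 , 0) ≟ₘ m)
    ... | true  = trans (ℚP.+-identityʳ _) (cong (a ℚ.+_) (sym (ℚP.+-identityʳ b)))
    ... | false = refl

  constₚ-0 : constₚ 0ℚ ≋ []
  constₚ-0 = ≋⟨ at ⟩
    where
    at : ∀ m → coeff (constₚ 0ℚ) m ≡ 0ℚ
    at m with does ((0 , 0 , 0) ≟ₘ m)
    ... | true  = refl
    ... | false = refl

  constₚ-morphism : ℚ.+-*-rawRing -Raw-AlmostCommutative⟶ fromCommutativeRing polyRing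
  constₚ-morphism = record
    { ⟦_⟧    = constₚ
    ; +-homo = constₚ-+
    ; *-homo = λ a b → ≋⟨ (λ m → refl) ⟩
    ; -‿homo = λ a → ≋⟨ (λ m → refl) ⟩
    ; 0-homo = constₚ-0
    ; 1-homo = ≋⟨ (λ m → refl) ⟩
    }

  constₚ-≟ : ∀ a b → Maybe (constₚ a ≋ constₚ b)
  constₚ-≟ a b with a ℚ.≟ b
  ... | yes refl = just ≋⟨ (λ m → refl) ⟩
  ... | no _     = nothing

  open import Algebra.Solver.Ring ℚ.+-*-rawRing (fromCommutativeRing polyRing) constₚ-morphism constₚ-≟ public


module IntegralDomain where

  -- ℚ[y,q,z] is an integral domain: the product of the leading terms (for
  -- the lexicographic order of monomials) of two nonzero polynomials is the
  -- leading term of their product and cannot cancel.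

  open import Defs using (Mono; _≟ₘ_; _+ₘ_; Poly; coeff; _+ₚ_; -ₚ_; _*ₚ_)
  open FiniteSums
  open PolynomialRing
  open import Data.Rational as ℚ using (ℚ; 0ℚ; 1ℚ)
  import Data.Rational.Properties as ℚP
  open import Data.Nat using (suc; _<_; _≤_; z≤n; s≤s)
  import Data.Nat.Properties as ℕP
  open import Data.Product using (Σ; ∃; _×_; _,_; proj₁; proj₂)
  open import Data.List using ([]; _∷_; length)
  open import Data.List.Relation.Unary.Any using (Any; here; there)
  open import Data.Bool using (true; false; if_then_else_)
  open import Data.Maybe using (just; nothing)
  open import Data.Sum using (_⊎_; inj₁; inj₂)
  open import Data.Empty using (⊥-elim)
  open import Relation.Nullary using (¬_)
  open import Relation.Nullary.Decidable using (does; yes; no; dec-true; dec-false)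
  open import Relation.Binary.Definitions using (tri<; tri≈; tri>)
  open import Relation.Binary.PropositionalEquality
  open import Algebra.Bundles using (CommutativeRing)

  infix 4 _<ₘ_ _≤ₘ_
  data _<ₘ_ : Mono → Mono → Set where
    <₁ : ∀ {a b c a' b' c'} → a < a' → (a , b , c) <ₘ (a' , b' , c')
    <₂ : ∀ {a b c b' c'}    → b < b' → (a , b , c) <ₘ (a , b' , c')
    <₃ : ∀ {a b c c'}       → c < c' → (a , b , c) <ₘ (a , b , c')

  _≤ₘ_ : Mono → Mono → Set
  m ≤ₘ m' = m <ₘ m' ⊎ m ≡ m'

  <ₘ-irrefl : ∀ {m} → ¬ m <ₘ m
  <ₘ-irrefl (<₁ p) = ℕP.<-irrefl refl p
  <ₘ-irrefl (<₂ p) = ℕP.<-irrefl refl p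
  <ₘ-irrefl (<₃ p) = ℕP.<-irrefl refl p

  <ₘ-trans : ∀ {m m' m''} → m <ₘ m' → m' <ₘ m'' → m <ₘ m''
  <ₘ-trans (<₁ p) (<₁ q) = <₁ (ℕP.<-trans p q)
  <ₘ-trans (<₁ p) (<₂ q) = <₁ p
  <ₘ-trans (<₁ p) (<₃ q) = <₁ p
  <ₘ-trans (<₂ p) (<₁ q) = <₁ q
  <ₘ-trans (<₂ p) (<₂ q) = <₂ (ℕP.<-trans p q)
  <ₘ-trans (<₂ p) (<₃ q) = <₂ p
  <ₘ-trans (<₃ p) (<₁ q) = <₁ q
  <ₘ-trans (<₃ p) (<₂ q) = <₂ q
  <ₘ-trans (<₃ p) (<₃ q) = <₃ (ℕP.<-trans p q)

  ≤ₘ-<ₘ-trans : ∀ {m m' m''} → m ≤ₘ m' → m' <ₘ m'' → m ≤ₘ m''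
  ≤ₘ-<ₘ-trans (inj₁ m<m') m'<m'' = inj₁ (<ₘ-trans m<m' m'<m'')
  ≤ₘ-<ₘ-trans (inj₂ refl) m'<m'' = inj₁ m'<m''

  <ₘ-cmp : ∀ m m' → m ≤ₘ m' ⊎ m' <ₘ m
  <ₘ-cmp (a , b , c) (a' , b' , c') with ℕP.<-cmp a a'
  ... | tri< p _ _ = inj₁ (inj₁ (<₁ p))
  ... | tri> _ _ p = inj₂ (<₁ p)
  ... | tri≈ _ refl _ with ℕP.<-cmp b b'
  ...   | tri< p _ _ = inj₁ (inj₁ (<₂ p))
  ...   | tri> _ _ p = inj₂ (<₂ p)
  ...   | tri≈ _ refl _ with ℕP.<-cmp c c'
  ...     | tri< p _ _ = inj₁ (inj₁ (<₃ p))
  ...     | tri> _ _ p = inj₂ (<₃ p)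
  ...     | tri≈ _ refl _ = inj₁ (inj₂ refl)

  +ₘ-monoˡ-< : ∀ {a m} b → a <ₘ m → a +ₘ b <ₘ m +ₘ b
  +ₘ-monoˡ-< (b₁ , b₂ , b₃) (<₁ p) = <₁ (ℕP.+-monoˡ-< b₁ p)
  +ₘ-monoˡ-< (b₁ , b₂ , b₃) (<₂ p) = <₂ (ℕP.+-monoˡ-< b₂ p)
  +ₘ-monoˡ-< (b₁ , b₂ , b₃) (<₃ p) = <₃ (ℕP.+-monoˡ-< b₃ p)

  +ₘ-monoʳ-< : ∀ m {b m'} → b <ₘ m' → m +ₘ b <ₘ m +ₘ m'
  +ₘ-monoʳ-< (m₁ , m₂ , m₃) (<₁ p) = <₁ (ℕP.+-monoʳ-< m₁ p)
  +ₘ-monoʳ-< (m₁ , m₂ , m₃) (<₂ p) = <₂ (ℕP.+-monoʳ-< m₂ p)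
  +ₘ-monoʳ-< (m₁ , m₂ , m₃) (<₃ p) = <₃ (ℕP.+-monoʳ-< m₃ p)

  +ₘ-mono-<-≤ : ∀ {a m b m'} → a <ₘ m → b ≤ₘ m' → a +ₘ b <ₘ m +ₘ m'
  +ₘ-mono-<-≤ {m = m} {b} a<m (inj₁ b<m') = <ₘ-trans (+ₘ-monoˡ-< b a<m) (+ₘ-monoʳ-< m b<m')
  +ₘ-mono-<-≤ {b = b} a<m (inj₂ refl) = +ₘ-monoˡ-< b a<m

  IsZeroₚ : Poly → Set
  IsZeroₚ p = ∀ m → coeff p m ≡ 0ℚ

  NonZeroₚ : Poly → Set
  NonZeroₚ p = ¬ IsZeroₚ p

  occurs : ∀ p m → coeff p m ≢ 0ℚ → Any (λ t → proj₂ t ≡ m) p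
  occurs []       m c≢0 = ⊥-elim (c≢0 refl)
  occurs (t ∷ p) m c≢0 with proj₂ t ≟ₘ m
  ... | yes t≡m = here t≡m
  ... | no  _   = there (occurs p m c≢0)

  zero? : ∀ p → IsZeroₚ p ⊎ ∃ λ m → coeff p m ≢ 0ℚ
  zero? p with search p
    where
    search : ∀ l → (∃ λ m → coeff p m ≢ 0ℚ) ⊎ (∀ m → Any (λ t → proj₂ t ≡ m) l → coeff p m ≡ 0ℚ)
    search []      = inj₂ (λ m ())
    search (t ∷ l) with coeff p (proj₂ t) ℚ.≟ 0ℚ | search l
    ... | no  c≢0 | _           = inj₁ (proj₂ t , c≢0)
    ... | yes _   | inj₁ w      = inj₁ w
    ... | yes c≡0 | inj₂ zeroes = inj₂ λ { m (here refl) → c≡0 ; m (there m∈l) → zeroes m m∈l }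
  ... | inj₁ w      = inj₂ w
  ... | inj₂ zeroes = inj₁ λ m → case-coeff m
    where
    case-coeff : ∀ m → coeff p m ≡ 0ℚ
    case-coeff m with coeff p m ℚ.≟ 0ℚ
    ... | yes c≡0 = c≡0
    ... | no  c≢0 = zeroes m (occurs p m c≢0)

  Leading : Poly → Mono → Set
  Leading p m = coeff p m ≢ 0ℚ × (∀ a → coeff p a ≢ 0ℚ → a ≤ₘ m)

  leading : ∀ p → NonZeroₚ p → ∃ (Leading p)
  leading p p≢0 with zero? p
  ... | inj₁ p≡0 = ⊥-elim (p≢0 p≡0)
  ... | inj₂ (m₀ , c₀≢0) with scan p
    where
    scan : ∀ l → Σ Mono λ m → coeff p m ≢ 0ℚ × (∀ a → Any (λ t → proj₂ t ≡ a) l → coeff p a ≢ 0ℚ → a ≤ₘ m)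
    scan []      = m₀ , c₀≢0 , λ a ()
    scan (t ∷ l) with scan l | coeff p (proj₂ t) ℚ.≟ 0ℚ
    ... | m , c≢0 , below | yes c≡0 = m , c≢0 , λ { a (here refl) c'≢0 → ⊥-elim (c'≢0 c≡0)
                                                  ; a (there a∈l) c'≢0 → below a a∈l c'≢0 }
    ... | m , c≢0 , below | no c'≢0 with <ₘ-cmp (proj₂ t) m
    ...   | inj₁ t≤m = m , c≢0 , λ { a (here refl) _ → t≤m ; a (there a∈l) c''≢0 → below a a∈l c''≢0 }
    ...   | inj₂ m<t = proj₂ t , c'≢0 , λ { a (here refl) _ → inj₂ refl
                                          ; a (there a∈l) c''≢0 → ≤ₘ-<ₘ-trans (below a a∈l c''≢0) m<t }
  ... | m , c≢0 , below = m , c≢0 , λ a c'≢0 → below a (occurs p a c'≢0) c'≢0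

  -- The linear functional r ↦ Σ h(m)·c over the terms c·m of r, for weights
  -- h : Mono → ℚ.  The coefficient at M of a product has this form, and so
  -- does evaluation at a point.

  weighted : (Mono → ℚ) → Poly → ℚ
  weighted h r = sumBy (λ s → h (proj₂ s) ℚ.* proj₁ s) r

  remove : Mono → Poly → Poly
  remove m []      = []
  remove m (t ∷ r) = if does (proj₂ t ≟ₘ m) then remove m r else t ∷ remove m r

  remove-length : ∀ m r → length (remove m r) ≤ length r
  remove-length m []      = z≤n
  remove-length m (t ∷ r) with does (proj₂ t ≟ₘ m)
  ... | true  = ℕP.m≤n⇒m≤1+n (remove-length m r)
  ... | false = s≤s (remove-length m r)

  coeff-remove-≡ : ∀ m r → coeff (remove m r) m ≡ 0ℚ
  coeff-remove-≡ m []      = refl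
  coeff-remove-≡ m (t ∷ r) with proj₂ t ≟ₘ m
  ... | yes _   = coeff-remove-≡ m r
  ... | no  t≢m rewrite dec-false (proj₂ t ≟ₘ m) t≢m = coeff-remove-≡ m r

  coeff-remove-≢ : ∀ m a r → a ≢ m → coeff (remove m r) a ≡ coeff r a
  coeff-remove-≢ m a []      a≢m = refl
  coeff-remove-≢ m a (t ∷ r) a≢m with proj₂ t ≟ₘ m
  ... | yes refl rewrite dec-false (proj₂ t ≟ₘ a) (λ t≡a → a≢m (sym t≡a)) = coeff-remove-≢ m a r a≢m
  ... | no  _ with does (proj₂ t ≟ₘ a)
  ...   | true  = cong (proj₁ t ℚ.+_) (coeff-remove-≢ m a r a≢m)
  ...   | false = coeff-remove-≢ m a r a≢m

  weighted-split : ∀ h r m → weighted h r ≡ h m ℚ.* coeff r m ℚ.+ weighted h (remove m r)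
  weighted-split h []      m = sym (trans (ℚP.+-identityʳ _) (ℚP.*-zeroʳ (h m)))
  weighted-split h ((c , a) ∷ r) m with a ≟ₘ m
  ... | yes refl = begin
    h a ℚ.* c ℚ.+ weighted h r                                    ≡⟨ cong (h a ℚ.* c ℚ.+_) (weighted-split h r a) ⟩
    h a ℚ.* c ℚ.+ (h a ℚ.* coeff r a ℚ.+ weighted h (remove a r)) ≡⟨ sym (ℚP.+-assoc (h a ℚ.* c) _ _) ⟩
    h a ℚ.* c ℚ.+ h a ℚ.* coeff r a ℚ.+ weighted h (remove a r)   ≡⟨ cong (ℚ._+ weighted h (remove a r)) (sym (ℚP.*-distribˡ-+ (h a) c _)) ⟩
    h a ℚ.* (c ℚ.+ coeff r a) ℚ.+ weighted h (remove a r)         ∎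
    where open ≡-Reasoning
  ... | no _ = begin
    h a ℚ.* c ℚ.+ weighted h r                                      ≡⟨ cong (h a ℚ.* c ℚ.+_) (weighted-split h r m) ⟩
    h a ℚ.* c ℚ.+ (h m ℚ.* coeff r m ℚ.+ weighted h (remove m r))   ≡⟨ sym (ℚP.+-assoc (h a ℚ.* c) _ _) ⟩
    h a ℚ.* c ℚ.+ h m ℚ.* coeff r m ℚ.+ weighted h (remove m r)     ≡⟨ cong (ℚ._+ weighted h (remove m r)) (ℚP.+-comm (h a ℚ.* c) _) ⟩
    h m ℚ.* coeff r m ℚ.+ h a ℚ.* c ℚ.+ weighted h (remove m r)     ≡⟨ ℚP.+-assoc (h m ℚ.* coeff r m) _ _ ⟩
    h m ℚ.* coeff r m ℚ.+ (h a ℚ.* c ℚ.+ weighted h (remove m r))   ∎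
    where open ≡-Reasoning

  weighted-vanishes : ∀ h r → (∀ a → coeff r a ≡ 0ℚ ⊎ h a ≡ 0ℚ) → weighted h r ≡ 0ℚ
  weighted-vanishes h r = go (length r) r ℕP.≤-refl
    where
    go : ∀ n r → length r ≤ n → (∀ a → coeff r a ≡ 0ℚ ⊎ h a ≡ 0ℚ) → weighted h r ≡ 0ℚ
    go n       []      _          _       = refl
    go (suc n) (t ∷ r) (s≤s |r|≤n) vanish =
      trans (weighted-split h (t ∷ r) m) (trans (cong₂ ℚ._+_ leading-term rest) (ℚP.+-identityʳ 0ℚ))
      where
      m : Mono
      m = proj₂ t
      leading-term : h m ℚ.* coeff (t ∷ r) m ≡ 0ℚ
      leading-term with vanish m
      ... | inj₁ c≡0 = trans (cong (h m ℚ.*_) c≡0) (ℚP.*-zeroʳ (h m))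
      ... | inj₂ h≡0 = trans (cong (ℚ._* coeff (t ∷ r) m) h≡0) (ℚP.*-zeroˡ (coeff (t ∷ r) m))
      shorter : length (remove m (t ∷ r)) ≤ n
      shorter rewrite dec-true (m ≟ₘ m) refl = ℕP.≤-trans (remove-length m r) |r|≤n
      vanish' : ∀ a → coeff (remove m (t ∷ r)) a ≡ 0ℚ ⊎ h a ≡ 0ℚ
      vanish' a with a ≟ₘ m
      ... | yes refl = inj₁ (coeff-remove-≡ a (t ∷ r))
      ... | no  a≢m with vanish a
      ...   | inj₁ c≡0 = inj₁ (trans (coeff-remove-≢ m a (t ∷ r) a≢m) c≡0)
      ...   | inj₂ h≡0 = inj₂ h≡0
      rest : weighted h (remove m (t ∷ r)) ≡ 0ℚ
      rest = go n (remove m (t ∷ r)) shorter vanish'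

  ℚ-*-nonzero : ∀ x y → x ≢ 0ℚ → y ≢ 0ℚ → x ℚ.* y ≢ 0ℚ
  ℚ-*-nonzero x y x≢0 y≢0 xy≡0 = x≢0 (begin
    x                      ≡⟨ sym (ℚP.*-identityʳ x) ⟩
    x ℚ.* 1ℚ               ≡⟨ cong (x ℚ.*_) (sym (ℚP.*-inverseʳ y)) ⟩
    x ℚ.* (y ℚ.* 1/y)      ≡⟨ sym (ℚP.*-assoc x y _) ⟩
    x ℚ.* y ℚ.* 1/y        ≡⟨ cong (ℚ._* 1/y) xy≡0 ⟩
    0ℚ ℚ.* 1/y             ≡⟨ ℚP.*-zeroˡ 1/y ⟩
    0ℚ                     ∎)
    where
    open ≡-Reasoning
    instance
      y-nonZero : ℚ.NonZero y
      y-nonZero = ℚ.≢-nonZero y≢0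
    1/y : ℚ
    1/y = ℚ.1/ y

  -- The coefficient of p · r at the product of the leading monomials is the
  -- product of the leading coefficients.
  *ₚ-nonzero : ∀ p r → NonZeroₚ p → NonZeroₚ r → NonZeroₚ (p *ₚ r)
  *ₚ-nonzero p r p≢0 r≢0 pr≡0 with leading p p≢0 | leading r r≢0
  ... | m , cₚ≢0 , below-m | m' , cᵣ≢0 , below-m' = ℚ-*-nonzero _ _ cₚ≢0 cᵣ≢0 top-coeff≡0
    where
    M : Mono
    M = m' +ₘ m
    g : Mono → ℚ
    g a = coeffAt p (M ∸ₘ a)
    g-m' : g m' ≡ coeff p m
    g-m' rewrite +ₘ-∸ₘ m' m = refl
    vanish : ∀ a → coeff (remove m' r) a ≡ 0ℚ ⊎ g a ≡ 0ℚ
    vanish a with a ≟ₘ m'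
    ... | yes refl = inj₁ (coeff-remove-≡ a r)
    ... | no a≢m' with coeff r a ℚ.≟ 0ℚ
    ...   | yes c≡0 = inj₁ (trans (coeff-remove-≢ m' a r a≢m') c≡0)
    ...   | no  c≢0 with below-m' a c≢0
    ...     | inj₂ a≡m' = ⊥-elim (a≢m' a≡m')
    ...     | inj₁ a<m' with M ∸ₘ a in M∸a
    ...       | nothing = inj₂ refl
    ...       | just d with coeff p d ℚ.≟ 0ℚ
    ...         | yes c'≡0 = inj₂ c'≡0
    ...         | no  c'≢0 = ⊥-elim (<ₘ-irrefl (subst (_<ₘ M) (∸ₘ-sound M a d M∸a)
                                                     (+ₘ-mono-<-≤ a<m' (below-m d c'≢0))))
    top-coeff≡0 : coeff p m ℚ.* coeff r m' ≡ 0ℚ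
    top-coeff≡0 = begin
      coeff p m ℚ.* coeff r m'                     ≡⟨ cong (ℚ._* coeff r m') (sym g-m') ⟩
      g m' ℚ.* coeff r m'                          ≡⟨ sym (ℚP.+-identityʳ _) ⟩
      g m' ℚ.* coeff r m' ℚ.+ 0ℚ                   ≡⟨ cong (g m' ℚ.* coeff r m' ℚ.+_) (sym (weighted-vanishes g (remove m' r) vanish)) ⟩
      g m' ℚ.* coeff r m' ℚ.+ weighted g (remove m' r) ≡⟨ sym (weighted-split g r m') ⟩
      weighted g r                                 ≡⟨ sym (coeff-*-grouped p r M) ⟩
      coeff (p *ₚ r) M                             ≡⟨ pr≡0 M ⟩
      0ℚ                                           ∎
      where open ≡-Reasoning

  private module P = CommutativeRing polyRing
  open import Algebra.Properties.Group P.+-group using (x∙y⁻¹≈ε⇒x≈y)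

  *ₚ-cancelˡ : ∀ d x y → NonZeroₚ d → (d *ₚ x) ≋ (d *ₚ y) → x ≋ y
  *ₚ-cancelˡ d x y d≢0 dx≋dy with zero? (x +ₚ (-ₚ y))
  ... | inj₁ x-y≡0 = x∙y⁻¹≈ε⇒x≈y x y ≋⟨ x-y≡0 ⟩
  ... | inj₂ (m , c≢0) = ⊥-elim (*ₚ-nonzero d (x +ₚ (-ₚ y)) d≢0 (λ x-y≡0 → c≢0 (x-y≡0 m)) (coeffwise d[x-y]≋0))
    where
    open import Relation.Binary.Reasoning.Setoid P.setoid
    d[x-y]≋0 : (d *ₚ (x +ₚ (-ₚ y))) ≋ []
    d[x-y]≋0 = begin
      d *ₚ (x +ₚ (-ₚ y))           ≈⟨ P.distribˡ d x (-ₚ y) ⟩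
      (d *ₚ x) +ₚ (d *ₚ (-ₚ y))    ≈⟨ P.+-congʳ dx≋dy ⟩
      (d *ₚ y) +ₚ (d *ₚ (-ₚ y))    ≈⟨ P.sym (P.distribˡ d y (-ₚ y)) ⟩
      d *ₚ (y +ₚ (-ₚ y))           ≈⟨ P.*-congˡ {d} (P.-‿inverseʳ y) ⟩
      d *ₚ []                      ≈⟨ P.zeroʳ d ⟩
      []                           ∎


module Evaluation where

  -- On fractions
  -- we track values through a ⇓ v ("a has value v, and its denominator has
  -- value 1"), which is how the needed nonvanishing facts are obtained.

  open import Defs using (Mono; _+ₘ_; Poly; _+ₚ_; -ₚ_; _*ₚ_; constₚ; K; num; den; _+_; -_; _*_; fromℚ)
  open FiniteSums
  open PolynomialRing
  open IntegralDomain
  open import Data.Rational as ℚ using (ℚ; 0ℚ; 1ℚ)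
  import Data.Rational.Properties as ℚP
  open import Data.Nat using (zero; suc)
  open import Data.Product using (_,_; proj₁; proj₂)
  open import Data.Sum using (inj₁)
  open import Relation.Binary.PropositionalEquality
  open import Algebra.Bundles using (CommutativeMonoid)
  open import Algebra.Properties.CommutativeSemigroup
    (CommutativeMonoid.commutativeSemigroup ℚP.*-1-commutativeMonoid) using (interchange)

  monoValue : Mono → ℚ
  monoValue (a , zero  , c) = 1ℚ
  monoValue (a , suc b , c) = 0ℚ

  monoValue-+ₘ : ∀ m m' → monoValue (m +ₘ m') ≡ monoValue m ℚ.* monoValue m'
  monoValue-+ₘ (a , zero  , c) (a' , zero    , c') = refl
  monoValue-+ₘ (a , zero  , c) (a' , suc b' , c') = refl
  monoValue-+ₘ (a , suc b , c) m'                  = sym (ℚP.*-zeroˡ (monoValue m'))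

  eval : Poly → ℚ
  eval = weighted monoValue

  eval-+ : ∀ p r → eval (p +ₚ r) ≡ eval p ℚ.+ eval r
  eval-+ p r = sumBy-++ _ p r

  eval-neg : ∀ p → eval (-ₚ p) ≡ ℚ.- eval p
  eval-neg p =
    trans (sumBy-map _ _ p)
      (trans (sumBy-cong (λ t → sym (ℚP.neg-distribʳ-* (monoValue (proj₂ t)) (proj₁ t))) p) (sumBy-neg _ p))

  eval-* : ∀ p r → eval (p *ₚ r) ≡ eval p ℚ.* eval r
  eval-* p r =
    trans (sumBy-concatMap _ _ p)
      (trans (sumBy-cong (λ t → trans (sumBy-map _ _ r)
                                 (trans (sumBy-cong (term-product t) r) (sumBy-*ˡ (value t) _ r))) p)
             (sumBy-*ʳ (eval r) _ p))
    where
    value : Term → ℚ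
    value t = monoValue (proj₂ t) ℚ.* proj₁ t
    term-product : ∀ t s → value (t *ₜ s) ≡ value t ℚ.* value s
    term-product (c , m) (c' , m') =
      trans (cong (ℚ._* (c ℚ.* c')) (monoValue-+ₘ m m')) (interchange (monoValue m) (monoValue m') c c')

  eval-const : ∀ c → eval (constₚ c) ≡ c
  eval-const c = trans (ℚP.+-identityʳ _) (ℚP.*-identityˡ c)

  nonzero-by-evaluation : ∀ p → eval p ≢ 0ℚ → NonZeroₚ p
  nonzero-by-evaluation p eval≢0 p≡0 = eval≢0 (weighted-vanishes monoValue p (λ a → inj₁ (p≡0 a)))

  infix 4 _⇓_
  record _⇓_ (a : K) (v : ℚ) : Set where
    constructor values
    field
      num-value : eval (num a) ≡ v
      den-value : eval (den a) ≡ 1ℚ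

  ⇓-nonzero : ∀ {a v} → a ⇓ v → v ≢ 0ℚ → NonZeroₚ (num a)
  ⇓-nonzero {a} (values num≡v _) v≢0 = nonzero-by-evaluation (num a) (λ num≡0 → v≢0 (trans (sym num≡v) num≡0))

  ⇓-const : ∀ c → fromℚ c ⇓ c
  ⇓-const c = values (eval-const c) (eval-const 1ℚ)

  ⇓-neg : ∀ {a u} → a ⇓ u → - a ⇓ ℚ.- u
  ⇓-neg {a} (values num≡u den≡1) = values (trans (eval-neg (num a)) (cong ℚ.-_ num≡u)) den≡1

  ⇓-* : ∀ {a b u v} → a ⇓ u → b ⇓ v → a * b ⇓ u ℚ.* v
  ⇓-* {a} {b} (values na≡u da≡1) (values nb≡v db≡1) = values
    (trans (eval-* (num a) (num b)) (cong₂ ℚ._*_ na≡u nb≡v))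
    (trans (eval-* (den a) (den b)) (cong₂ ℚ._*_ da≡1 db≡1))

  ⇓-+ : ∀ {a b u v} → a ⇓ u → b ⇓ v → a + b ⇓ u ℚ.+ v
  ⇓-+ {a} {b} {u} {v} (values na≡u da≡1) (values nb≡v db≡1) = values
    (trans (eval-+ (num a *ₚ den b) (num b *ₚ den a))
      (cong₂ ℚ._+_ (trans (eval-* (num a) (den b)) (trans (cong₂ ℚ._*_ na≡u db≡1) (ℚP.*-identityʳ u)))
                   (trans (eval-* (num b) (den a)) (trans (cong₂ ℚ._*_ nb≡v da≡1) (ℚP.*-identityʳ v)))))
    (trans (eval-* (den a) (den b)) (cong₂ ℚ._*_ da≡1 db≡1))

  ⇓-*-zeroʳ : ∀ {a b u} → a ⇓ u → b ⇓ 0ℚ → a * b ⇓ 0ℚ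
  ⇓-*-zeroʳ {u = u} a⇓u b⇓0 with ⇓-* a⇓u b⇓0
  ... | values num≡ den≡ = values (trans num≡ (ℚP.*-zeroʳ u)) den≡


module FractionField where

  -- The fractions num/den of Defs whose denominator is a nonzero polynomial
  -- form a commutative ring K⁺ under cross-multiplication equality: the
  -- laws are polynomial identities in numerators and denominators, and
  -- transitivity cancels the (nonzero) middle denominator.

  open import Defs using (Poly; coeff; constₚ; _+ₚ_; -ₚ_; _*ₚ_; isZero?; K; num; den; _/_; _+_; -_; _*_; _⁻¹; fromℚ; 0K; 1K)
  open PolynomialRing
  open PolynomialSolver
  open IntegralDomain
  open Evaluation using (nonzero-by-evaluation)
  open import Data.Rational as ℚ using (ℚ; 0ℚ; 1ℚ)
  open import Data.Product using (Σ; _,_; proj₁; proj₂)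
  open import Data.List using ([])
  open import Data.Maybe using (Maybe; just; nothing)
  open import Relation.Nullary.Decidable using (yes; no; dec-false)
  open import Data.Bool using (if_then_else_)
  open import Data.List.Relation.Unary.All as All using (All)
  import Relation.Binary.PropositionalEquality as ≡
  open import Algebra.Bundles using (CommutativeRing)
  open import Algebra.Structures using (IsCommutativeRing)
  open import Algebra.Solver.Ring.AlmostCommutativeRing
  open import Level using (0ℓ)

  private
    module P = CommutativeRing polyRing
  open import Relation.Binary.Reasoning.Setoid P.setoid

  infix 4 _≈ᶠ_
  _≈ᶠ_ : K → K → Set
  a ≈ᶠ b = (num a *ₚ den b) ≋ (num b *ₚ den a)

  ≈ᶠ-trans : ∀ a b c → NonZeroₚ (den b) → a ≈ᶠ b → b ≈ᶠ c → a ≈ᶠ c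
  ≈ᶠ-trans a b c db≢0 a≈b b≈c = *ₚ-cancelˡ db (na *ₚ dc) (nc *ₚ da) db≢0 (begin
    db *ₚ (na *ₚ dc) ≈⟨ solve 3 (λ db na dc → db :* (na :* dc) := (na :* db) :* dc) P.refl db na dc ⟩
    (na *ₚ db) *ₚ dc ≈⟨ P.*-congʳ a≈b ⟩
    (nb *ₚ da) *ₚ dc ≈⟨ solve 3 (λ nb da dc → (nb :* da) :* dc := da :* (nb :* dc)) P.refl nb da dc ⟩
    da *ₚ (nb *ₚ dc) ≈⟨ P.*-congˡ {da} b≈c ⟩
    da *ₚ (nc *ₚ db) ≈⟨ solve 3 (λ da nc db → da :* (nc :* db) := db :* (nc :* da)) P.refl da nc db ⟩
    db *ₚ (nc *ₚ da) ∎)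
    where
    na da nb db nc dc : Poly
    na = num a ; da = den a ; nb = num b ; db = den b ; nc = num c ; dc = den c

  +ᶠ-cong : ∀ a a' b b' → a ≈ᶠ a' → b ≈ᶠ b' → a + b ≈ᶠ a' + b'
  +ᶠ-cong a a' b b' a≈a' b≈b' = begin
    ((na *ₚ db) +ₚ (nb *ₚ da)) *ₚ (da' *ₚ db')
      ≈⟨ solve 6 (λ na da da' nb db db' → (na :* db :+ nb :* da) :* (da' :* db')
                   := (na :* da') :* (db :* db') :+ (nb :* db') :* (da :* da')) P.refl na da da' nb db db' ⟩
    ((na *ₚ da') *ₚ (db *ₚ db')) +ₚ ((nb *ₚ db') *ₚ (da *ₚ da'))
      ≈⟨ P.+-cong (P.*-congʳ a≈a') (P.*-congʳ b≈b') ⟩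
    ((na' *ₚ da) *ₚ (db *ₚ db')) +ₚ ((nb' *ₚ db) *ₚ (da *ₚ da'))
      ≈⟨ solve 6 (λ na' da da' nb' db db' → (na' :* da) :* (db :* db') :+ (nb' :* db) :* (da :* da')
                   := (na' :* db' :+ nb' :* da') :* (da :* db)) P.refl na' da da' nb' db db' ⟩
    ((na' *ₚ db') +ₚ (nb' *ₚ da')) *ₚ (da *ₚ db) ∎
    where
    na da na' da' nb db nb' db' : Poly
    na = num a ; da = den a ; na' = num a' ; da' = den a' ; nb = num b ; db = den b ; nb' = num b' ; db' = den b'

  *ᶠ-cong : ∀ a a' b b' → a ≈ᶠ a' → b ≈ᶠ b' → a * b ≈ᶠ a' * b'
  *ᶠ-cong a a' b b' a≈a' b≈b' = begin
    (na *ₚ nb) *ₚ (da' *ₚ db')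
      ≈⟨ solve 4 (λ na da' nb db' → (na :* nb) :* (da' :* db') := (na :* da') :* (nb :* db')) P.refl na da' nb db' ⟩
    (na *ₚ da') *ₚ (nb *ₚ db')
      ≈⟨ P.*-cong a≈a' b≈b' ⟩
    (na' *ₚ da) *ₚ (nb' *ₚ db)
      ≈⟨ solve 4 (λ na' da nb' db → (na' :* da) :* (nb' :* db) := (na' :* nb') :* (da :* db)) P.refl na' da nb' db ⟩
    (na' *ₚ nb') *ₚ (da *ₚ db) ∎
    where
    na da na' da' nb db nb' db' : Poly
    na = num a ; da = den a ; na' = num a' ; da' = den a' ; nb = num b ; db = den b ; nb' = num b' ; db' = den b'

  -ᶠ-cong : ∀ a a' → a ≈ᶠ a' → - a ≈ᶠ - a'
  -ᶠ-cong a a' a≈a' = begin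
    (-ₚ na) *ₚ da'   ≈⟨ solve 2 (λ na da' → (:- na) :* da' := :- (na :* da')) P.refl na da' ⟩
    -ₚ (na *ₚ da')   ≈⟨ P.-‿cong a≈a' ⟩
    -ₚ (na' *ₚ da)   ≈⟨ solve 2 (λ na' da → :- (na' :* da) := (:- na') :* da) P.refl na' da ⟩
    (-ₚ na') *ₚ da   ∎
    where
    na da na' da' : Poly
    na = num a ; da = den a ; na' = num a' ; da' = den a'

  +ᶠ-assoc : ∀ a b c → (a + b) + c ≈ᶠ a + (b + c)
  +ᶠ-assoc a b c = solve 6 (λ na da nb db nc dc →
    ((na :* db :+ nb :* da) :* dc :+ nc :* (da :* db)) :* (da :* (db :* dc))
    := (na :* (db :* dc) :+ (nb :* dc :+ nc :* db) :* da) :* ((da :* db) :* dc))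
    P.refl (num a) (den a) (num b) (den b) (num c) (den c)

  +ᶠ-comm : ∀ a b → a + b ≈ᶠ b + a
  +ᶠ-comm a b = solve 4 (λ na da nb db → (na :* db :+ nb :* da) :* (db :* da) := (nb :* da :+ na :* db) :* (da :* db))
    P.refl (num a) (den a) (num b) (den b)

  +ᶠ-identityˡ : ∀ a → 0K + a ≈ᶠ a
  +ᶠ-identityˡ a = solve 2 (λ na da → (con 0ℚ :* da :+ na :* con 1ℚ) :* da := na :* (con 1ℚ :* da))
    P.refl (num a) (den a)

  +ᶠ-identityʳ : ∀ a → a + 0K ≈ᶠ a
  +ᶠ-identityʳ a = solve 2 (λ na da → (na :* con 1ℚ :+ con 0ℚ :* da) :* da := na :* (da :* con 1ℚ))
    P.refl (num a) (den a)

  -ᶠ-inverseˡ : ∀ a → (- a) + a ≈ᶠ 0K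
  -ᶠ-inverseˡ a = solve 2 (λ na da → ((:- na) :* da :+ na :* da) :* con 1ℚ := con 0ℚ :* (da :* da))
    P.refl (num a) (den a)

  -ᶠ-inverseʳ : ∀ a → a + (- a) ≈ᶠ 0K
  -ᶠ-inverseʳ a = solve 2 (λ na da → (na :* da :+ (:- na) :* da) :* con 1ℚ := con 0ℚ :* (da :* da))
    P.refl (num a) (den a)

  *ᶠ-assoc : ∀ a b c → (a * b) * c ≈ᶠ a * (b * c)
  *ᶠ-assoc a b c = solve 6 (λ na da nb db nc dc →
    ((na :* nb) :* nc) :* (da :* (db :* dc)) := (na :* (nb :* nc)) :* ((da :* db) :* dc))
    P.refl (num a) (den a) (num b) (den b) (num c) (den c)

  *ᶠ-comm : ∀ a b → a * b ≈ᶠ b * a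
  *ᶠ-comm a b = solve 4 (λ na da nb db → (na :* nb) :* (db :* da) := (nb :* na) :* (da :* db))
    P.refl (num a) (den a) (num b) (den b)

  *ᶠ-identityˡ : ∀ a → 1K * a ≈ᶠ a
  *ᶠ-identityˡ a = solve 2 (λ na da → (con 1ℚ :* na) :* da := na :* (con 1ℚ :* da)) P.refl (num a) (den a)

  *ᶠ-identityʳ : ∀ a → a * 1K ≈ᶠ a
  *ᶠ-identityʳ a = solve 2 (λ na da → (na :* con 1ℚ) :* da := na :* (da :* con 1ℚ)) P.refl (num a) (den a)

  *ᶠ-distribˡ : ∀ a b c → a * (b + c) ≈ᶠ (a * b) + (a * c)
  *ᶠ-distribˡ a b c = solve 6 (λ na da nb db nc dc →
    (na :* (nb :* dc :+ nc :* db)) :* ((da :* db) :* (da :* dc))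
    := ((na :* nb) :* (da :* dc) :+ (na :* nc) :* (da :* db)) :* (da :* (db :* dc)))
    P.refl (num a) (den a) (num b) (den b) (num c) (den c)

  *ᶠ-distribʳ : ∀ a b c → (b + c) * a ≈ᶠ (b * a) + (c * a)
  *ᶠ-distribʳ a b c = solve 6 (λ na da nb db nc dc →
    ((nb :* dc :+ nc :* db) :* na) :* ((db :* da) :* (dc :* da))
    := ((nb :* na) :* (dc :* da) :+ (nc :* na) :* (db :* da)) :* ((db :* dc) :* da))
    P.refl (num a) (den a) (num b) (den b) (num c) (den c)

  K⁺ : Set
  K⁺ = Σ K λ a → NonZeroₚ (den a)

  1≢0 : NonZeroₚ (constₚ 1ℚ)
  1≢0 = nonzero-by-evaluation (constₚ 1ℚ) (λ ())

  fromℚ⁺ : ℚ → K⁺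
  fromℚ⁺ c = fromℚ c , 1≢0

  0⁺ 1⁺ : K⁺
  0⁺ = fromℚ⁺ 0ℚ
  1⁺ = fromℚ⁺ 1ℚ

  -- Inverses.  Defs inverts a fraction whose numerator is not syntactically
  -- zero by swapping numerator and denominator; for a numerator that is a
  -- nonzero polynomial this is an inverse.

  zero-terms⇒zero : ∀ p → All (λ t → coeff p (proj₂ t) ≡.≡ 0ℚ) p → IsZeroₚ p
  zero-terms⇒zero p all-zero m with coeff p m ℚ.≟ 0ℚ
  ... | yes c≡0 = c≡0
  ... | no  c≢0 = All.lookupWith {R = λ _ → coeff p m ≡.≡ 0ℚ} (λ { c≡0 ≡.refl → c≡0 }) all-zero (occurs p m c≢0)

  ⁻¹-den-nonzero : ∀ a → NonZeroₚ (den (a ⁻¹))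
  ⁻¹-den-nonzero a with isZero? (num a)
  ... | yes _        = 1≢0
  ... | no  not-zero = λ na≡0 → not-zero (All.tabulate (λ {t} _ → na≡0 (proj₂ t)))

  ⁻¹-swap : ∀ a → NonZeroₚ (num a) → a ⁻¹ ≡.≡ den a / num a
  ⁻¹-swap a na≢0 = ≡.cong (λ b → if b then 0K else den a / num a)
    (dec-false (isZero? (num a)) λ na≡0 → na≢0 (zero-terms⇒zero (num a) na≡0))

  -- The operations of K⁺ are opaque: apart from the proofs of their laws,
  -- and the final comparison with Defs, they are used only through those
  -- laws.  This keeps terms small and lets Agda infer arguments of the laws.

  infixl 6 _+⁺_
  infixl 7 _*⁺_
  infix  9 _⁻¹⁺
  infix  4 _≈⁺_

  opaque
    _+⁺_ : K⁺ → K⁺ → K⁺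
    (a , da≢0) +⁺ (b , db≢0) = a + b , *ₚ-nonzero (den a) (den b) da≢0 db≢0

    _*⁺_ : K⁺ → K⁺ → K⁺
    (a , da≢0) *⁺ (b , db≢0) = a * b , *ₚ-nonzero (den a) (den b) da≢0 db≢0

    -⁺_ : K⁺ → K⁺
    -⁺ (a , da≢0) = - a , da≢0

    _⁻¹⁺ : K⁺ → K⁺
    (a , _) ⁻¹⁺ = a ⁻¹ , ⁻¹-den-nonzero a

  -- The equality of K⁺, as a record so that Agda can recover its arguments.
  record _≈⁺_ (a b : K⁺) : Set where
    constructor ⁺⟨_⟩
    field cross : proj₁ a ≈ᶠ proj₁ b
  open _≈⁺_ public

  opaque
    unfolding _+⁺_ _*⁺_ -⁺_

    K⁺-isCommutativeRing : IsCommutativeRing _≈⁺_ _+⁺_ _*⁺_ -⁺_ 0⁺ 1⁺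
    K⁺-isCommutativeRing = record
      { isRing = record
        { +-isAbelianGroup = record
          { isGroup = record
            { isMonoid = record
              { isSemigroup = record
                { isMagma = record
                  { isEquivalence = record
                    { refl  = ⁺⟨ P.refl ⟩
                    ; sym   = λ a≈b → ⁺⟨ P.sym (cross a≈b) ⟩
                    ; trans = λ {a} {b} {c} a≈b b≈c →
                        ⁺⟨ ≈ᶠ-trans (proj₁ a) (proj₁ b) (proj₁ c) (proj₂ b) (cross a≈b) (cross b≈c) ⟩ }
                  ; ∙-cong = λ {a} {a'} {b} {b'} a≈a' b≈b' →
                      ⁺⟨ +ᶠ-cong (proj₁ a) (proj₁ a') (proj₁ b) (proj₁ b') (cross a≈a') (cross b≈b') ⟩ }
                ; assoc = λ a b c → ⁺⟨ +ᶠ-assoc (proj₁ a) (proj₁ b) (proj₁ c) ⟩ }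
              ; identity = (λ a → ⁺⟨ +ᶠ-identityˡ (proj₁ a) ⟩) , (λ a → ⁺⟨ +ᶠ-identityʳ (proj₁ a) ⟩) }
            ; inverse = (λ a → ⁺⟨ -ᶠ-inverseˡ (proj₁ a) ⟩) , (λ a → ⁺⟨ -ᶠ-inverseʳ (proj₁ a) ⟩)
            ; ⁻¹-cong = λ {a} {a'} a≈a' → ⁺⟨ -ᶠ-cong (proj₁ a) (proj₁ a') (cross a≈a') ⟩ }
          ; comm = λ a b → ⁺⟨ +ᶠ-comm (proj₁ a) (proj₁ b) ⟩ }
        ; *-cong = λ {a} {a'} {b} {b'} a≈a' b≈b' →
            ⁺⟨ *ᶠ-cong (proj₁ a) (proj₁ a') (proj₁ b) (proj₁ b') (cross a≈a') (cross b≈b') ⟩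
        ; *-assoc = λ a b c → ⁺⟨ *ᶠ-assoc (proj₁ a) (proj₁ b) (proj₁ c) ⟩
        ; *-identity = (λ a → ⁺⟨ *ᶠ-identityˡ (proj₁ a) ⟩) , (λ a → ⁺⟨ *ᶠ-identityʳ (proj₁ a) ⟩)
        ; distrib = (λ a b c → ⁺⟨ *ᶠ-distribˡ (proj₁ a) (proj₁ b) (proj₁ c) ⟩)
                  , (λ a b c → ⁺⟨ *ᶠ-distribʳ (proj₁ a) (proj₁ b) (proj₁ c) ⟩) }
      ; *-comm = λ a b → ⁺⟨ *ᶠ-comm (proj₁ a) (proj₁ b) ⟩ }

  Kring : CommutativeRing 0ℓ 0ℓ
  Kring = record
    { Carrier = K⁺ ; _≈_ = _≈⁺_ ; _+_ = _+⁺_ ; _*_ = _*⁺_ ; -_ = -⁺_ ; 0# = 0⁺ ; 1# = 1⁺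
    ; isCommutativeRing = K⁺-isCommutativeRing }

  nonzero-transfer : ∀ {a b} → a ≈⁺ b → NonZeroₚ (num (proj₁ b)) → NonZeroₚ (num (proj₁ a))
  nonzero-transfer {a , da≢0} {b , _} a≈b nb≢0 na≡0 = *ₚ-nonzero (num b) (den a) nb≢0 da≢0 (coeffwise nb·da≋0)
    where
    nb·da≋0 : (num b *ₚ den a) ≋ []
    nb·da≋0 = P.trans (P.sym (cross a≈b)) (P.trans (P.*-cong {num a} {[]} {den b} {den b} ≋⟨ na≡0 ⟩ P.refl) (P.zeroˡ (den b)))

  opaque
    unfolding _*⁺_ _⁻¹⁺

    ⁻¹⁺-inverseʳ : ∀ a → NonZeroₚ (num (proj₁ a)) → a *⁺ a ⁻¹⁺ ≈⁺ 1⁺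
    ⁻¹⁺-inverseʳ (a , _) na≢0 = ⁺⟨ ≡.subst (λ a⁻¹ → a * a⁻¹ ≈ᶠ 1K) (≡.sym (⁻¹-swap a na≢0))
      (solve 2 (λ na da → (na :* da) :* con 1ℚ := con 1ℚ :* (da :* na)) P.refl (num a) (den a)) ⟩

  module K⁺-Solver where

    opaque
      unfolding _+⁺_ _*⁺_ -⁺_

      fromℚ⁺-+ : ∀ a b → fromℚ⁺ (a ℚ.+ b) ≈⁺ fromℚ⁺ a +⁺ fromℚ⁺ b
      fromℚ⁺-+ a b = ⁺⟨ P.trans (P.*-congʳ (constₚ-+ a b))
        (solve 2 (λ A B → (A :+ B) :* (con 1ℚ :* con 1ℚ) := (A :* con 1ℚ :+ B :* con 1ℚ) :* con 1ℚ)
               P.refl (constₚ a) (constₚ b)) ⟩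

      fromℚ⁺-* : ∀ a b → fromℚ⁺ (a ℚ.* b) ≈⁺ fromℚ⁺ a *⁺ fromℚ⁺ b
      fromℚ⁺-* a b = ⁺⟨ solve 2 (λ A B → (A :* B) :* (con 1ℚ :* con 1ℚ) := (A :* B) :* con 1ℚ)
                         P.refl (constₚ a) (constₚ b) ⟩

      fromℚ⁺-neg : ∀ a → fromℚ⁺ (ℚ.- a) ≈⁺ -⁺ fromℚ⁺ a
      fromℚ⁺-neg a = ⁺⟨ P.refl ⟩

    fromℚ⁺-morphism : ℚ.+-*-rawRing -Raw-AlmostCommutative⟶ fromCommutativeRing Kring
    fromℚ⁺-morphism = record
      { ⟦_⟧ = fromℚ⁺ ; +-homo = fromℚ⁺-+ ; *-homo = fromℚ⁺-* ; -‿homo = fromℚ⁺-neg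
      ; 0-homo = ⁺⟨ P.refl ⟩ ; 1-homo = ⁺⟨ P.refl ⟩ }

    fromℚ⁺-≟ : ∀ a b → Maybe (fromℚ⁺ a ≈⁺ fromℚ⁺ b)
    fromℚ⁺-≟ a b with a ℚ.≟ b
    ... | yes ≡.refl = just ⁺⟨ P.refl ⟩
    ... | no _       = nothing

    open import Algebra.Solver.Ring ℚ.+-*-rawRing (fromCommutativeRing Kring) fromℚ⁺-morphism fromℚ⁺-≟ public


module Matrices where

  -- The operations are defined over any raw ring,
  -- so that the same matrix expressions can be read both in K⁺ and in the
  -- syntax of the ring solver, and they are written as in Defs (for example
  -- x - y = x + (- y)); the laws hold in any commutative ring.

  open import Algebra.Bundles using (CommutativeRing)
  open import Algebra.Bundles.Raw using (RawRing)
  open import Data.Nat as ℕ using (ℕ; zero; suc)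
  open import Data.Product using (_×_; _,_)
  open import Relation.Binary.Bundles using (Setoid)

  module MatrixOps {c ℓ} (R : RawRing c ℓ) where

    open RawRing R

    infixl 6 _-_
    infixr 8 _^_
    infixl 7 _·_

    _-_ : Carrier → Carrier → Carrier
    x - y = x + (- y)

    _^_ : Carrier → ℕ → Carrier
    x ^ zero  = 1#
    x ^ suc n = x * x ^ n

    2# : Carrier
    2# = 1# + 1#

    record Mat : Set c where
      constructor mat
      field m₁₁ m₁₂ m₂₁ m₂₂ : Carrier
    open Mat public

    _·_ : Mat → Mat → Mat
    A · B = mat (m₁₁ A * m₁₁ B + m₁₂ A * m₂₁ B) (m₁₁ A * m₁₂ B + m₁₂ A * m₂₂ B)
                (m₂₁ A * m₁₁ B + m₂₂ A * m₂₁ B) (m₂₁ A * m₁₂ B + m₂₂ A * m₂₂ B)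

    I₂ : Mat
    I₂ = mat 1# 0# 0# 1#

    scale : Carrier → Mat → Mat
    scale c A = mat (c * m₁₁ A) (c * m₁₂ A) (c * m₂₁ A) (c * m₂₂ A)

    det : Mat → Carrier
    det A = m₁₁ A * m₂₂ A - m₁₂ A * m₂₁ A

    adj : Mat → Mat
    adj A = mat (m₂₂ A) (- m₁₂ A) (- m₂₁ A) (m₁₁ A)

  module MatrixLaws {c ℓ} (R : CommutativeRing c ℓ) where

    open CommutativeRing R hiding (_-_)
    open MatrixOps rawRing public
    open import Algebra.Properties.CommutativeSemigroup +-commutativeSemigroup using (interchange)
    open import Algebra.Properties.Ring ring using (-‿distribˡ-*)
    open import Relation.Binary.Reasoning.Setoid setoid

    ^-+ : ∀ x m n → x ^ (m ℕ.+ n) ≈ x ^ m * x ^ n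
    ^-+ x zero    n = sym (*-identityˡ (x ^ n))
    ^-+ x (suc m) n = trans (*-congˡ (^-+ x m n)) (sym (*-assoc x (x ^ m) (x ^ n)))

    infix 4 _≈M_
    _≈M_ : Mat → Mat → Set ℓ
    A ≈M B = (m₁₁ A ≈ m₁₁ B) × (m₁₂ A ≈ m₁₂ B) × (m₂₁ A ≈ m₂₁ B) × (m₂₂ A ≈ m₂₂ B)

    ≈M-refl : ∀ {A} → A ≈M A
    ≈M-refl = refl , refl , refl , refl

    ≈M-sym : ∀ {A B} → A ≈M B → B ≈M A
    ≈M-sym (e₁ , e₂ , e₃ , e₄) = sym e₁ , sym e₂ , sym e₃ , sym e₄

    ≈M-trans : ∀ {A B C} → A ≈M B → B ≈M C → A ≈M C
    ≈M-trans (e₁ , e₂ , e₃ , e₄) (f₁ , f₂ , f₃ , f₄) = trans e₁ f₁ , trans e₂ f₂ , trans e₃ f₃ , trans e₄ f₄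

    matSetoid : Setoid c ℓ
    matSetoid = record
      { Carrier = Mat ; _≈_ = _≈M_
      ; isEquivalence = record { refl = ≈M-refl ; sym = ≈M-sym ; trans = ≈M-trans } }

    ·-cong : ∀ {A A' B B'} → A ≈M A' → B ≈M B' → A · B ≈M A' · B'
    ·-cong (a₁₁ , a₁₂ , a₂₁ , a₂₂) (b₁₁ , b₁₂ , b₂₁ , b₂₂) =
      +-cong (*-cong a₁₁ b₁₁) (*-cong a₁₂ b₂₁) , +-cong (*-cong a₁₁ b₁₂) (*-cong a₁₂ b₂₂) ,
      +-cong (*-cong a₂₁ b₁₁) (*-cong a₂₂ b₂₁) , +-cong (*-cong a₂₁ b₁₂) (*-cong a₂₂ b₂₂)

    ·-assoc-entry : ∀ a b e f g h x y →
      (a * e + b * g) * x + (a * f + b * h) * y ≈ a * (e * x + f * y) + b * (g * x + h * y)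
    ·-assoc-entry a b e f g h x y = begin
      (a * e + b * g) * x + (a * f + b * h) * y
        ≈⟨ +-cong (distribʳ x (a * e) (b * g)) (distribʳ y (a * f) (b * h)) ⟩
      (a * e * x + b * g * x) + (a * f * y + b * h * y)
        ≈⟨ +-cong (+-cong (*-assoc a e x) (*-assoc b g x)) (+-cong (*-assoc a f y) (*-assoc b h y)) ⟩
      (a * (e * x) + b * (g * x)) + (a * (f * y) + b * (h * y))
        ≈⟨ interchange (a * (e * x)) (b * (g * x)) (a * (f * y)) (b * (h * y)) ⟩
      (a * (e * x) + a * (f * y)) + (b * (g * x) + b * (h * y))
        ≈⟨ +-cong (distribˡ a (e * x) (f * y)) (distribˡ b (g * x) (h * y)) ⟨
      a * (e * x + f * y) + b * (g * x + h * y) ∎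

    ·-assoc : ∀ A B C → (A · B) · C ≈M A · (B · C)
    ·-assoc (mat a₁₁ a₁₂ a₂₁ a₂₂) (mat b₁₁ b₁₂ b₂₁ b₂₂) (mat c₁₁ c₁₂ c₂₁ c₂₂) =
      ·-assoc-entry a₁₁ a₁₂ b₁₁ b₁₂ b₂₁ b₂₂ c₁₁ c₂₁ , ·-assoc-entry a₁₁ a₁₂ b₁₁ b₁₂ b₂₁ b₂₂ c₁₂ c₂₂ ,
      ·-assoc-entry a₂₁ a₂₂ b₁₁ b₁₂ b₂₁ b₂₂ c₁₁ c₂₁ , ·-assoc-entry a₂₁ a₂₂ b₁₁ b₁₂ b₂₁ b₂₂ c₁₂ c₂₂

    ·-identityˡ : ∀ A → I₂ · A ≈M A
    ·-identityˡ (mat a b c d) = one-zero a c , one-zero b d , zero-one a c , zero-one b d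
      where
      one-zero : ∀ x y → 1# * x + 0# * y ≈ x
      one-zero x y = trans (+-cong (*-identityˡ x) (zeroˡ y)) (+-identityʳ x)
      zero-one : ∀ x y → 0# * x + 1# * y ≈ y
      zero-one x y = trans (+-cong (zeroˡ x) (*-identityˡ y)) (+-identityˡ y)

    ·-identityʳ : ∀ A → A · I₂ ≈M A
    ·-identityʳ (mat a b c d) = one-zero a b , zero-one a b , one-zero c d , zero-one c d
      where
      one-zero : ∀ x y → x * 1# + y * 0# ≈ x
      one-zero x y = trans (+-cong (*-identityʳ x) (zeroʳ y)) (+-identityʳ x)
      zero-one : ∀ x y → x * 0# + y * 1# ≈ y
      zero-one x y = trans (+-cong (zeroʳ x) (*-identityʳ y)) (+-identityˡ y)

    adj-inverseˡ : ∀ δ A → δ * det A ≈ 1# → scale δ (adj A) · A ≈M I₂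
    adj-inverseˡ δ (mat a b c d) δdet≈1 =
      trans (pull d a (- b) c) (trans (*-congˡ det≈) δdet≈1) ,
      trans (pull d b (- b) d) (trans (*-congˡ (cancel (d * b) b d (*-comm d b))) (zeroʳ δ)) ,
      trans (pull (- c) a a c) (trans (*-congˡ (trans (+-comm _ _) (cancel (a * c) c a (*-comm a c))))
                                       (zeroʳ δ)) ,
      trans (pull (- c) b a d) (trans (*-congˡ det≈') δdet≈1)
      where
      pull : ∀ x y x' y' → δ * x * y + δ * x' * y' ≈ δ * (x * y + x' * y')
      pull x y x' y' = trans (+-cong (*-assoc δ x y) (*-assoc δ x' y')) (sym (distribˡ δ (x * y) (x' * y')))
      cancel : ∀ u v w → u ≈ v * w → u + (- v) * w ≈ 0#
      cancel u v w u≈vw = trans (+-cong u≈vw (sym (-‿distribˡ-* v w))) (-‿inverseʳ (v * w))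
      det≈ : d * a + (- b) * c ≈ a * d - b * c
      det≈ = +-cong (*-comm d a) (sym (-‿distribˡ-* b c))
      det≈' : (- c) * b + a * d ≈ a * d - b * c
      det≈' = trans (+-comm _ _) (+-congˡ (trans (sym (-‿distribˡ-* c b)) (-‿cong (*-comm c b))))

  module Telescoping {c ℓ} (R : CommutativeRing c ℓ) where

    open MatrixLaws R
    open import Relation.Binary.Reasoning.Setoid matSetoid

    leftProduct rightProduct : (ℕ → Mat) → ℕ → Mat
    leftProduct  F zero    = I₂
    leftProduct  F (suc n) = F n · leftProduct F n
    rightProduct F zero    = I₂
    rightProduct F (suc n) = rightProduct F n · F n

    module _ (A Ā B X : ℕ → Mat)
             (Ā·A≈I : ∀ k → Ā k · A k ≈M I₂)
             (A·X≈X·B : ∀ k → A k · X (suc k) ≈M X k · B k) where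

      left-inverse : ∀ n → leftProduct Ā n · rightProduct A n ≈M I₂
      left-inverse zero    = ·-identityˡ I₂
      left-inverse (suc n) = begin
        (Ā n · Ā* n) · (A* n · A n)   ≈⟨ ·-assoc (Ā n) (Ā* n) (A* n · A n) ⟩
        Ā n · (Ā* n · (A* n · A n))   ≈⟨ ·-cong ≈M-refl (≈M-sym (·-assoc (Ā* n) (A* n) (A n))) ⟩
        Ā n · ((Ā* n · A* n) · A n)   ≈⟨ ·-cong ≈M-refl (·-cong (left-inverse n) ≈M-refl) ⟩
        Ā n · (I₂ · A n)              ≈⟨ ·-cong ≈M-refl (·-identityˡ (A n)) ⟩
        Ā n · A n                     ≈⟨ Ā·A≈I n ⟩
        I₂                            ∎
        where Ā* = leftProduct Ā ; A* = rightProduct A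

      shift : ∀ n → rightProduct A n · X n ≈M X zero · rightProduct B n
      shift zero    = ≈M-trans (·-identityˡ (X zero)) (≈M-sym (·-identityʳ (X zero)))
      shift (suc n) = begin
        (A* n · A n) · X (suc n)   ≈⟨ ·-assoc (A* n) (A n) (X (suc n)) ⟩
        A* n · (A n · X (suc n))   ≈⟨ ·-cong ≈M-refl (A·X≈X·B n) ⟩
        A* n · (X n · B n)         ≈⟨ ≈M-sym (·-assoc (A* n) (X n) (B n)) ⟩
        (A* n · X n) · B n         ≈⟨ ·-cong (shift n) ≈M-refl ⟩
        (X zero · B* n) · B n      ≈⟨ ·-assoc (X zero) (B* n) (B n) ⟩
        X zero · (B* n · B n)      ∎
        where A* = rightProduct A ; B* = rightProduct B

      telescope : ∀ n → leftProduct Ā n · X zero · rightProduct B n ≈M X n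
      telescope n = begin
        (Ā* · X zero) · B*   ≈⟨ ·-assoc Ā* (X zero) B* ⟩
        Ā* · (X zero · B*)   ≈⟨ ·-cong ≈M-refl (≈M-sym (shift n)) ⟩
        Ā* · (A* · X n)      ≈⟨ ≈M-sym (·-assoc Ā* A* (X n)) ⟩
        (Ā* · A*) · X n      ≈⟨ ·-cong (left-inverse n) ≈M-refl ⟩
        I₂ · X n             ≈⟨ ·-identityˡ (X n) ⟩
        X n                  ∎
        where Ā* = leftProduct Ā n ; A* = rightProduct A n ; B* = rightProduct B n


module KeyIdentity where

  -- The matrices of the theorem as expressions over a ring, with ȳ standing
  -- for y⁻¹ and c for the prefactor 1/((1 − yzq)(1 − ȳzq)), and the
  -- identities between them in K⁺:
  --   * the intertwining relation  M(w,z) · C(wq², wq³) = C(w, wq) · M(w, zq²),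
  --     where C(a,b) is the claimed closed form with q^{2n}, q^{2n+1}
  --     replaced by a, b;
  --   * the base case  C(1, q) = S;
  --   * the factorisation of det M(w,z).
  -- Each rests on a polynomial identity checked by the ring solver; the
  -- relations y ȳ = 1 etc. enter through multiples of u − v that vanish
  -- when u ≈ v.

  open Matrices
  open FractionField
  open import Algebra.Bundles using (CommutativeRing)
  open import Algebra.Bundles.Raw using (RawRing)
  open import Data.Rational using (0ℚ; 1ℚ)
  open import Data.Nat using (ℕ)
  open import Data.Product using (_,_)
  open import Relation.Binary.PropositionalEquality using (_≡_)
  open import Level using (0ℓ)

  module Shapes {c ℓ} (R : RawRing c ℓ) where

    open RawRing R
    open MatrixOps R public

    M : (q y ȳ w z : Carrier) → Mat
    M q y ȳ w z = mat (z * (1# - w * q ^ 2) ^ 2) (- 1# - z) (z * (1# + z) * (1# - w * q ^ 2) ^ 2)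
                      ((1# + w * q * y) * (1# + w * q * ȳ) * z - (1# + z) ^ 2)

    -- M(w,z) with the product y ȳ replaced by 1.
    Mˢ : (q y ȳ w z : Carrier) → Mat
    Mˢ q y ȳ w z = mat (z * (1# - w * q ^ 2) ^ 2) (- 1# - z) (z * (1# + z) * (1# - w * q ^ 2) ^ 2)
                       ((1# + w * q * (y + ȳ) + w * q * (w * q)) * z - (1# + z) ^ 2)

    -- S, with a' and b' standing for 1/(1 − zqy) and 1/(1 − zqȳ).
    S : (q z a' b' : Carrier) → Mat
    S q z a' b' = mat (z * q ^ 2) (a' + b' - 1#) 0# 1#

    -- The closed form, with a and b standing for q^{2n} and q^{2n+1}.
    C : (q y ȳ z c a b : Carrier) → Mat
    C q y ȳ z c a b = scale c
      (mat (q ^ 2 * z * (2# * a - z * b * (y + ȳ) + z ^ 2 * q ^ 2 - 1#))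
           (1# - z ^ 2 * q ^ 2)
           ((1# - a) ^ 2 * (z ^ 2 * q ^ 2 - 1#) * z * q ^ 2)
           (z * b * (2# * q * z - y - ȳ) + 1# - z ^ 2 * q ^ 2))

  open CommutativeRing Kring using (_≈_; _+_; _*_; -_; 0#; 1#; setoid; refl; sym; trans; +-cong; +-congˡ;
    +-congʳ; *-cong; *-congˡ; *-congʳ; -‿cong; -‿inverseʳ; zeroʳ; +-identityʳ)
  open MatrixLaws Kring
  open Shapes (CommutativeRing.rawRing Kring) using (M; Mˢ; S; C)
  open K⁺-Solver using (Polynomial; _:+_; _:*_; :-_; _:-_; con; _:=_; solve)

  -- The solver's expressions in n variables as a raw ring, so that the shapes
  -- above can also be written as solver input.
  Syntax : ℕ → RawRing 0ℓ 0ℓ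
  Syntax n = record
    { Carrier = Polynomial n ; _≈_ = _≡_ ; _+_ = _:+_ ; _*_ = _:*_ ; -_ = :-_ ; 0# = con 0ℚ ; 1# = con 1ℚ }

  drop-residual : ∀ {x l u v} → u ≈ v → x + l * (u - v) ≈ x
  drop-residual {x} {l} {u} {v} u≈v = begin
    x + l * (u - v)   ≈⟨ +-congˡ (*-congˡ (+-congʳ u≈v)) ⟩
    x + l * (v - v)   ≈⟨ +-congˡ (*-congˡ (-‿inverseʳ v)) ⟩
    x + l * 0#        ≈⟨ +-congˡ (zeroʳ l) ⟩
    x + 0#            ≈⟨ +-identityʳ x ⟩
    x                 ∎
    where open import Relation.Binary.Reasoning.Setoid setoid

  M≈Mˢ : ∀ q y ȳ w z → y * ȳ ≈ 1# → M q y ȳ w z ≈M Mˢ q y ȳ w z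
  M≈Mˢ q y ȳ w z yȳ≈1 = refl , refl , refl , trans (expand q y ȳ w z) (drop-residual yȳ≈1)
    where
    module E = Shapes (Syntax 5)
    expand : ∀ q y ȳ w z → m₂₂ (M q y ȳ w z) ≈ m₂₂ (Mˢ q y ȳ w z) + w * q * (w * q) * z * (y * ȳ - 1#)
    expand = solve 5 (λ q y ȳ w z →
      E.m₂₂ (E.M q y ȳ w z) := E.m₂₂ (E.Mˢ q y ȳ w z) :+ w :* q :* (w :* q) :* z :* (y :* ȳ :- con 1ℚ)) refl

  det-M : ∀ q y ȳ w z →
          det (M q y ȳ w z) ≈ z * z * ((1# - w * q ^ 2) * (1# - w * q ^ 2)) * (1# + w * q * y) * (1# + w * q * ȳ)
  det-M = solve 5 (λ q y ȳ w z →
    E.det (E.M q y ȳ w z) := z :* z :* ((con 1ℚ :- w :* E._^_ q 2) :* (con 1ℚ :- w :* E._^_ q 2))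
                             :* (con 1ℚ :+ w :* q :* y) :* (con 1ℚ :+ w :* q :* ȳ)) refl
    where module E = Shapes (Syntax 5)

  C-cong : ∀ q y ȳ z c {a a' b b'} → a ≈ a' → b ≈ b' → C q y ȳ z c a b ≈M C q y ȳ z c a' b'
  C-cong q y ȳ z c {a} {a'} a≈a' b≈b' =
    *-congˡ (*-congˡ (+-congʳ (+-congʳ (+-cong (*-congˡ a≈a') (-‿cong (*-congʳ (*-congˡ b≈b'))))))) ,
    refl ,
    *-congˡ (*-congʳ (*-congʳ (*-congʳ (*-cong 1-a≈1-a' (*-congʳ 1-a≈1-a'))))) ,
    *-congˡ (+-congʳ (+-congʳ (*-congʳ (*-congˡ b≈b'))))
    where
    1-a≈1-a' : 1# - a ≈ 1# - a'
    1-a≈1-a' = +-congˡ (-‿cong a≈a')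

  intertwiningˢ : ∀ q y ȳ z c w →
    Mˢ q y ȳ w z · C q y ȳ z c (w * q ^ 2) (w * q ^ 2 * q) ≈M C q y ȳ z c w (w * q) · Mˢ q y ȳ w (z * q ^ 2)
  intertwiningˢ q y ȳ z c w = entry₁₁ q y ȳ z c w , entry₁₂ q y ȳ z c w , entry₂₁ q y ȳ z c w , entry₂₂ q y ȳ z c w
    where
    module E = Shapes (Syntax 6)
    Lhs Rhs : (q y ȳ z c w : K⁺) → Mat
    Lhs q y ȳ z c w = Mˢ q y ȳ w z · C q y ȳ z c (w * q ^ 2) (w * q ^ 2 * q)
    Rhs q y ȳ z c w = C q y ȳ z c w (w * q) · Mˢ q y ȳ w (z * q ^ 2)
    Lhsᴱ Rhsᴱ : (q y ȳ z c w : Polynomial 6) → E.Mat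
    Lhsᴱ q y ȳ z c w = E.Mˢ q y ȳ w z E.· E.C q y ȳ z c (w :* E._^_ q 2) (w :* E._^_ q 2 :* q)
    Rhsᴱ q y ȳ z c w = E.C q y ȳ z c w (w :* q) E.· E.Mˢ q y ȳ w (z :* E._^_ q 2)
    entry₁₁ : ∀ q y ȳ z c w → m₁₁ (Lhs q y ȳ z c w) ≈ m₁₁ (Rhs q y ȳ z c w)
    entry₁₁ = solve 6 (λ q y ȳ z c w → E.m₁₁ (Lhsᴱ q y ȳ z c w) := E.m₁₁ (Rhsᴱ q y ȳ z c w)) refl
    entry₁₂ : ∀ q y ȳ z c w → m₁₂ (Lhs q y ȳ z c w) ≈ m₁₂ (Rhs q y ȳ z c w)
    entry₁₂ = solve 6 (λ q y ȳ z c w → E.m₁₂ (Lhsᴱ q y ȳ z c w) := E.m₁₂ (Rhsᴱ q y ȳ z c w)) refl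
    entry₂₁ : ∀ q y ȳ z c w → m₂₁ (Lhs q y ȳ z c w) ≈ m₂₁ (Rhs q y ȳ z c w)
    entry₂₁ = solve 6 (λ q y ȳ z c w → E.m₂₁ (Lhsᴱ q y ȳ z c w) := E.m₂₁ (Rhsᴱ q y ȳ z c w)) refl
    entry₂₂ : ∀ q y ȳ z c w → m₂₂ (Lhs q y ȳ z c w) ≈ m₂₂ (Rhs q y ȳ z c w)
    entry₂₂ = solve 6 (λ q y ȳ z c w → E.m₂₂ (Lhsᴱ q y ȳ z c w) := E.m₂₂ (Rhsᴱ q y ȳ z c w)) refl

  intertwining : ∀ q y ȳ z c w {w₁ w₂ w₃} → y * ȳ ≈ 1# →
    w₁ ≈ w * q → w₂ ≈ w * q ^ 2 → w₃ ≈ w * q ^ 2 * q →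
    M q y ȳ w z · C q y ȳ z c w₂ w₃ ≈M C q y ȳ z c w w₁ · M q y ȳ w (z * q ^ 2)
  intertwining q y ȳ z c w {w₁} {w₂} {w₃} yȳ≈1 w₁≈ w₂≈ w₃≈ = begin
    M q y ȳ w z · C q y ȳ z c w₂ w₃
      ≈⟨ ·-cong (M≈Mˢ q y ȳ w z yȳ≈1) (C-cong q y ȳ z c w₂≈ w₃≈) ⟩
    Mˢ q y ȳ w z · C q y ȳ z c (w * q ^ 2) (w * q ^ 2 * q)
      ≈⟨ intertwiningˢ q y ȳ z c w ⟩
    C q y ȳ z c w (w * q) · Mˢ q y ȳ w (z * q ^ 2)
      ≈⟨ ·-cong (C-cong q y ȳ z c refl (sym w₁≈)) (≈M-sym (M≈Mˢ q y ȳ w (z * q ^ 2) yȳ≈1)) ⟩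
    C q y ȳ z c w w₁ · M q y ȳ w (z * q ^ 2) ∎
    where open import Relation.Binary.Reasoning.Setoid matSetoid

  base-case : ∀ q y ȳ z c a' b' → y * ȳ ≈ 1# → (1# - y * z * q) * (1# - ȳ * z * q) * c ≈ 1# →
    (1# - z * q * y) * a' ≈ 1# → (1# - z * q * ȳ) * b' ≈ 1# →
    C q y ȳ z c 1# (q ^ 1) ≈M S q z a' b'
  base-case q y ȳ z c a' b' yȳ≈1 Dc≈1 Aa'≈1 Bb'≈1 =
    trans (certificate₁₁ q y ȳ z c) (trans (drop-residual yȳ≈1) (drop-residual Dc≈1)) ,
    sym (trans (certificate₁₂ q y ȳ z c a' b')
               (trans (drop-residual yȳ≈1) (trans (drop-residual Bb'≈1)
                      (trans (drop-residual Aa'≈1) (drop-residual Dc≈1))))) ,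
    certificate₂₁ q y ȳ z c ,
    trans (certificate₂₂ q y ȳ z c) (trans (drop-residual yȳ≈1) (drop-residual Dc≈1))
    where
    module E₅ = Shapes (Syntax 5)
    module E₇ = Shapes (Syntax 7)
    D : (q y ȳ z : K⁺) → K⁺
    D q y ȳ z = (1# - y * z * q) * (1# - ȳ * z * q)
    Dᴱ : ∀ {n} (q y ȳ z : Polynomial n) → Polynomial n
    Dᴱ q y ȳ z = (con 1ℚ :- y :* z :* q) :* (con 1ℚ :- ȳ :* z :* q)
    certificate₁₁ : ∀ q y ȳ z c → m₁₁ (C q y ȳ z c 1# (q ^ 1)) ≈
      z * q ^ 2 + q ^ 2 * z * (D q y ȳ z * c - 1#) + - (q ^ 2 * z * c * z ^ 2 * q ^ 2) * (y * ȳ - 1#)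
    certificate₁₁ = solve 5 (λ q y ȳ z c → E₅.m₁₁ (E₅.C q y ȳ z c (con 1ℚ) (E₅._^_ q 1)) :=
      z :* E₅._^_ q 2 :+ E₅._^_ q 2 :* z :* (Dᴱ q y ȳ z :* c :- con 1ℚ)
      :+ :- (E₅._^_ q 2 :* z :* c :* E₅._^_ z 2 :* E₅._^_ q 2) :* (y :* ȳ :- con 1ℚ)) refl
    certificate₁₂ : ∀ q y ȳ z c a' b' → a' + b' - 1# ≈
      m₁₂ (C q y ȳ z c 1# (q ^ 1)) + (1# - a' - b') * (D q y ȳ z * c - 1#)
      + c * (1# - z * q * ȳ) * ((1# - z * q * y) * a' - 1#) + c * (1# - z * q * y) * ((1# - z * q * ȳ) * b' - 1#)
      + - (c * z ^ 2 * q ^ 2) * (y * ȳ - 1#)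
    certificate₁₂ = solve 7 (λ q y ȳ z c a' b' → a' :+ b' :- con 1ℚ :=
      E₇.m₁₂ (E₇.C q y ȳ z c (con 1ℚ) (E₇._^_ q 1)) :+ (con 1ℚ :- a' :- b') :* (Dᴱ q y ȳ z :* c :- con 1ℚ)
      :+ c :* (con 1ℚ :- z :* q :* ȳ) :* ((con 1ℚ :- z :* q :* y) :* a' :- con 1ℚ)
      :+ c :* (con 1ℚ :- z :* q :* y) :* ((con 1ℚ :- z :* q :* ȳ) :* b' :- con 1ℚ)
      :+ :- (c :* E₇._^_ z 2 :* E₇._^_ q 2) :* (y :* ȳ :- con 1ℚ)) refl
    certificate₂₁ : ∀ q y ȳ z c → m₂₁ (C q y ȳ z c 1# (q ^ 1)) ≈ 0#
    certificate₂₁ = solve 5 (λ q y ȳ z c → E₅.m₂₁ (E₅.C q y ȳ z c (con 1ℚ) (E₅._^_ q 1)) := con 0ℚ) refl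
    certificate₂₂ : ∀ q y ȳ z c → m₂₂ (C q y ȳ z c 1# (q ^ 1)) ≈
      1# + 1# * (D q y ȳ z * c - 1#) + - (c * z ^ 2 * q ^ 2) * (y * ȳ - 1#)
    certificate₂₂ = solve 5 (λ q y ȳ z c → E₅.m₂₂ (E₅.C q y ȳ z c (con 1ℚ) (E₅._^_ q 1)) :=
      con 1ℚ :+ con 1ℚ :* (Dᴱ q y ȳ z :* c :- con 1ℚ) :+ :- (c :* E₅._^_ z 2 :* E₅._^_ q 2) :* (y :* ȳ :- con 1ℚ)) refl


module Specialisation where

  open import Defs using (K; num; y; q; z; _⁻¹; Mwz; Ωclosed; Ω; Lprod; Rprod)
  import Defs
  open PolynomialRing using (coeffwise)
  open IntegralDomain using (NonZeroₚ)
  open Evaluation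
  open FractionField
  open Matrices
  open KeyIdentity
  open import Algebra.Bundles using (CommutativeRing)
  open import Algebra.Bundles.Raw using (RawRing)
  open import Data.Rational as ℚ using (ℚ; 0ℚ; 1ℚ)
  open import Data.Nat as ℕ using (ℕ; zero; suc)
  import Data.Nat.Properties as ℕP
  open import Data.Product using (Σ; _,_; proj₁; proj₂)
  open import Relation.Binary.PropositionalEquality as ≡ using (_≡_; cong; cong₂)
  open import Level using (0ℓ)

  open CommutativeRing Kring using (_≈_; _+_; _*_; 1#; trans; *-comm; *-congˡ; *-congʳ; *-identityʳ)
  open MatrixLaws Kring
  open Telescoping Kring
  open Shapes (CommutativeRing.rawRing Kring) using (M; S; C)

  y⁺ q⁺ z⁺ ȳ⁺ : K⁺
  y⁺ = y , 1≢0
  q⁺ = q , 1≢0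
  z⁺ = z , 1≢0
  ȳ⁺ = y⁺ ⁻¹⁺

  D⁺ A⁺ B⁺ c⁺ a'⁺ b'⁺ : K⁺
  D⁺  = (1# - y⁺ * z⁺ * q⁺) * (1# - ȳ⁺ * z⁺ * q⁺)
  A⁺  = 1# - z⁺ * q⁺ * y⁺
  B⁺  = 1# - z⁺ * q⁺ * ȳ⁺
  c⁺  = D⁺ ⁻¹⁺
  a'⁺ = A⁺ ⁻¹⁺
  b'⁺ = B⁺ ⁻¹⁺

  Mz Mzq² : ℕ → Mat
  Mz   k = M q⁺ y⁺ ȳ⁺ (q⁺ ^ (2 ℕ.* k)) z⁺
  Mzq² k = M q⁺ y⁺ ȳ⁺ (q⁺ ^ (2 ℕ.* k)) (z⁺ * q⁺ ^ 2)

  inv⁺ : Mat → Mat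
  inv⁺ A = scale (det A ⁻¹⁺) (adj A)

  Closed : ℕ → Mat
  Closed n = C q⁺ y⁺ ȳ⁺ z⁺ c⁺ (q⁺ ^ (2 ℕ.* n)) (q⁺ ^ (2 ℕ.* n ℕ.+ 1))

  -- The quantities inverted in the theorem are nonzero: their values at
  -- y = 1, q = 0, z = 1 are nonzero.
  opaque
    unfolding _+⁺_ _*⁺_ -⁺_ _⁻¹⁺

    y≢0 : NonZeroₚ (num (proj₁ y⁺))
    y≢0 = nonzero-by-evaluation (num y) (λ ())

    D≢0 : NonZeroₚ (num (proj₁ D⁺))
    D≢0 = nonzero-by-evaluation (num (proj₁ D⁺)) (λ ())

    A≢0 : NonZeroₚ (num (proj₁ A⁺))
    A≢0 = nonzero-by-evaluation (num (proj₁ A⁺)) (λ ())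

    B≢0 : NonZeroₚ (num (proj₁ B⁺))
    B≢0 = nonzero-by-evaluation (num (proj₁ B⁺)) (λ ())

    q⇓0 : q ⇓ 0ℚ
    q⇓0 = values ≡.refl ≡.refl

    y⇓1 : y ⇓ 1ℚ
    y⇓1 = values ≡.refl ≡.refl

    ȳ⇓1 : y ⁻¹ ⇓ 1ℚ
    ȳ⇓1 = values ≡.refl ≡.refl

    z⇓1 : z ⇓ 1ℚ
    z⇓1 = values ≡.refl ≡.refl

    q-power⇓ : ∀ k → Σ ℚ λ u → proj₁ (q⁺ ^ k) ⇓ u
    q-power⇓ zero    = 1ℚ , ⇓-const 1ℚ
    q-power⇓ (suc k) = 0ℚ ℚ.* proj₁ (q-power⇓ k) , ⇓-* q⇓0 (proj₂ (q-power⇓ k))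

    -- det M(w,z) = z² (1 − wq²)² (1 + wqy) (1 + wqȳ) has value 1.
    det≢0 : ∀ k → NonZeroₚ (num (proj₁ (det (Mz k))))
    det≢0 k = nonzero-transfer (det-M q⁺ y⁺ ȳ⁺ w z⁺) (⇓-nonzero factors⇓1 (λ ()))
      where
      w : K⁺
      w = q⁺ ^ (2 ℕ.* k)
      w⇓ : proj₁ w ⇓ proj₁ (q-power⇓ (2 ℕ.* k))
      w⇓ = proj₂ (q-power⇓ (2 ℕ.* k))
      wq⇓0 : proj₁ (w * q⁺) ⇓ 0ℚ
      wq⇓0 = ⇓-*-zeroʳ w⇓ q⇓0
      1-wq²⇓1 : proj₁ (1# - w * q⁺ ^ 2) ⇓ 1ℚ
      1-wq²⇓1 = ⇓-+ (⇓-const 1ℚ) (⇓-neg (⇓-*-zeroʳ w⇓ (⇓-* q⇓0 (⇓-* q⇓0 (⇓-const 1ℚ)))))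
      factors⇓1 : proj₁ (z⁺ * z⁺ * ((1# - w * q⁺ ^ 2) * (1# - w * q⁺ ^ 2)) * (1# + w * q⁺ * y⁺) * (1# + w * q⁺ * ȳ⁺)) ⇓ 1ℚ
      factors⇓1 = ⇓-* (⇓-* (⇓-* (⇓-* z⇓1 z⇓1) (⇓-* 1-wq²⇓1 1-wq²⇓1)) (⇓-+ (⇓-const 1ℚ) (⇓-* wq⇓0 y⇓1)))
                      (⇓-+ (⇓-const 1ℚ) (⇓-* wq⇓0 ȳ⇓1))

  yȳ≈1 : y⁺ * ȳ⁺ ≈ 1#
  yȳ≈1 = ⁻¹⁺-inverseʳ y⁺ y≢0

  Dc≈1 : D⁺ * c⁺ ≈ 1#
  Dc≈1 = ⁻¹⁺-inverseʳ D⁺ D≢0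

  Aa'≈1 : A⁺ * a'⁺ ≈ 1#
  Aa'≈1 = ⁻¹⁺-inverseʳ A⁺ A≢0

  Bb'≈1 : B⁺ * b'⁺ ≈ 1#
  Bb'≈1 = ⁻¹⁺-inverseʳ B⁺ B≢0

  Mz-inverse : ∀ k → inv⁺ (Mz k) · Mz k ≈M I₂
  Mz-inverse k = adj-inverseˡ (det (Mz k) ⁻¹⁺) (Mz k)
    (trans (*-comm _ _) (⁻¹⁺-inverseʳ (det (Mz k)) (det≢0 k)))

  step : ∀ k → Mz k · Closed (suc k) ≈M Closed k · Mzq² k
  step k = intertwining q⁺ y⁺ ȳ⁺ z⁺ c⁺ w yȳ≈1 (odd-power k) even-power
                     (trans (odd-power (suc k)) (*-congʳ even-power))
    where
    w : K⁺
    w = q⁺ ^ (2 ℕ.* k)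
    odd-power : ∀ j → q⁺ ^ (2 ℕ.* j ℕ.+ 1) ≈ q⁺ ^ (2 ℕ.* j) * q⁺
    odd-power j = trans (^-+ q⁺ (2 ℕ.* j) 1) (*-congˡ (*-identityʳ q⁺))
    even-power : q⁺ ^ (2 ℕ.* suc k) ≈ w * q⁺ ^ 2
    even-power = ≡.subst (λ e → q⁺ ^ e ≈ w * q⁺ ^ 2) (≡.sym (≡.trans (ℕP.*-suc 2 k) (ℕP.+-comm 2 (2 ℕ.* k))))
                         (^-+ q⁺ (2 ℕ.* k) 2)

  base : Closed 0 ≈M S q⁺ z⁺ a'⁺ b'⁺
  base = base-case q⁺ y⁺ ȳ⁺ z⁺ c⁺ a'⁺ b'⁺ yȳ≈1 Dc≈1 Aa'≈1 Bb'≈1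

  Ω⁺ : ℕ → Mat
  Ω⁺ n = leftProduct (λ k → inv⁺ (Mz k)) n · S q⁺ z⁺ a'⁺ b'⁺ · rightProduct Mzq² n

  K-rawRing : RawRing 0ℓ 0ℓ
  K-rawRing = record { Carrier = K ; _≈_ = Defs._≈_ ; _+_ = Defs._+_ ; _*_ = Defs._*_ ; -_ = Defs.-_
                ; 0# = Defs.0K ; 1# = Defs.1K }

  module ShapesK = Shapes K-rawRing

  project : Mat → Defs.Mat
  project A = Defs.mat (proj₁ (m₁₁ A)) (proj₁ (m₁₂ A)) (proj₁ (m₂₁ A)) (proj₁ (m₂₂ A))

  forget : ∀ {A B} → A ≈M B → project A Defs.≈M project B
  forget (e₁₁ , e₁₂ , e₂₁ , e₂₂) =
    coeffwise (cross e₁₁) , coeffwise (cross e₁₂) , coeffwise (cross e₂₁) , coeffwise (cross e₂₂)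

  -- With the operations of K⁺ unfolded, projection commutes with them
  -- definitionally; only powers with a variable exponent need induction.
  opaque
    unfolding _+⁺_ _*⁺_ -⁺_ _⁻¹⁺

    proj₁-^ : ∀ a k → proj₁ (a ^ k) ≡ proj₁ a Defs.^ k
    proj₁-^ a zero    = ≡.refl
    proj₁-^ a (suc k) = cong (proj₁ a Defs.*_) (proj₁-^ a k)

    project-Mz : ∀ k → project (Mz k) ≡ Mwz (q Defs.^ (2 ℕ.* k)) z
    project-Mz k = cong (λ w → Mwz w z) (proj₁-^ q⁺ (2 ℕ.* k))

    project-Mzq² : ∀ k → project (Mzq² k) ≡ Mwz (q Defs.^ (2 ℕ.* k)) (z Defs.* q Defs.^ 2)
    project-Mzq² k = cong (λ w → Mwz w (z Defs.* q Defs.^ 2)) (proj₁-^ q⁺ (2 ℕ.* k))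

    project-left : ∀ n → project (leftProduct (λ k → inv⁺ (Mz k)) n) ≡ Lprod n
    project-left zero    = ≡.refl
    project-left (suc n) = cong₂ (λ A L → Defs.inv A Defs.· L) (project-Mz n) (project-left n)

    project-right : ∀ n → project (rightProduct Mzq² n) ≡ Rprod n
    project-right zero    = ≡.refl
    project-right (suc n) = cong₂ Defs._·_ (project-right n) (project-Mzq² n)

    project-Ω : ∀ n → project (Ω⁺ n) ≡ Ω n
    project-Ω n = cong₂ (λ L R → L Defs.· Defs.S Defs.· R) (project-left n) (project-right n)

    project-Closed : ∀ n → project (Closed n) ≡ Ωclosed n
    project-Closed n = cong₂ (λ a b → toDefs (ShapesK.C q y (y ⁻¹) z (proj₁ c⁺) a b))
                             (proj₁-^ q⁺ (2 ℕ.* n)) (proj₁-^ q⁺ (2 ℕ.* n ℕ.+ 1))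
      where
      toDefs : ShapesK.Mat → Defs.Mat
      toDefs (ShapesK.mat a b c d) = Defs.mat a b c d

open import Defs using (Ω; Ωclosed; _≈M_)
open import Data.Nat using (ℕ)
open import Relation.Binary.PropositionalEquality using (subst₂)
open FractionField using (Kring)
open Matrices.MatrixLaws Kring using (≈M-refl; ≈M-sym; ≈M-trans; ·-cong) renaming (_≈M_ to _≈M⁺_)
open Matrices.Telescoping Kring using (telescope)
open Specialisation using (Ω⁺; Closed; Mz; Mzq²; inv⁺; Mz-inverse; step; base; forget; project-Ω; project-Closed)

lemma7p3 : (n : ℕ) → Ω n ≈M Ωclosed n
lemma7p3 n = subst₂ _≈M_ (project-Ω n) (project-Closed n) (forget Ω⁺≈Closed)
  where
  -- In K⁺, Ω_n multiplies S ≈ C_0 by the inverses of the M(q^{2k},z) on the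
  -- left and by the M(q^{2k},zq²) on the right; by the recursion
  -- M(q^{2k},z) · C_{k+1} ≈ C_k · M(q^{2k},zq²) this telescopes to C_n.
  Ω⁺≈Closed : Ω⁺ n ≈M⁺ Closed n
  Ω⁺≈Closed = ≈M-trans (·-cong (·-cong ≈M-refl (≈M-sym base)) ≈M-refl)
                       (telescope Mz (λ k → inv⁺ (Mz k)) Mzq² Closed Mz-inverse step n)
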